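{- Let $n\ge 3$ and $k\in[0,n-3]$. Let $A$ be the set of permutations $\pi$ of $[n]$ having exactly one occurrence of $132$, such that, writing this occurrence as letters $a,c,b$ (with $a<b<c$, appearing in the order $a,c,b$), exactly $k$ letters of $\pi$ lie strictly between $c$ and $b$ in position. Let $B$ be the set of permutations $\rho$ of $[n-k]$ having exactly one occurrence of $132$, which occupies three consecutive positions of $\rho$. Let $D$ be the set of permutations $\sigma$ of $[k+3]$ having exactly one occurrence of $132$, which occupies the first, second and last positions of $\sigma$. Then there is a bijection from $A$ to $B\times D$.
   Context: A permutation of $[n]$ is a word $\pi_1\cdots\pi_n$. An occurrence of $132$ in $\pi$ is a triple of positions $i<j<k$ with $\pi_i<\pi_k<\pi_j$. -}

module Defs where

open import Data.Nat using (ℕ; zero; suc; _∸_; _<?_; _≟_)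
open import Data.Fin using (Fin; toℕ)
import Data.Fin as F
open import Data.Vec using (Vec; lookup)
open import Data.List using (List; allFin; filter; length; concatMap; map; []; _∷_)
open import Data.Product using (_×_; _,_)
open import Data.Bool using (Bool; true; false; _∧_; _∨_; not; T)
open import Data.Bool.Properties using (T?)
open import Relation.Nullary.Decidable using (⌊_⌋)

allB : {A : Set} → (A → Bool) → List A → Bool
allB p [] = true
allB p (x ∷ xs) = p x ∧ allB p xs

-- A permutation of [n] is a word π₁⋯πₙ: a vector of length n over Fin n
-- (letter x ∈ Fin n stands for x+1 ∈ [n]) with pairwise distinct entries.
-- Distinctness is decided by checking all pairs of positions, so the
-- predicate is Bool-valued (proof-irrelevant membership).
isPerm : ∀ {n} → Vec (Fin n) n → Bool
isPerm {n} π =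
  allB (λ i → allB (λ j → ⌊ i F.≟ j ⌋ ∨ not ⌊ lookup π i F.≟ lookup π j ⌋) (allFin n)) (allFin n)

triples : (n : ℕ) → List (Fin n × Fin n × Fin n)
triples n = concatMap (λ i → concatMap (λ j → map (λ k → (i , j , k)) (allFin n)) (allFin n)) (allFin n)

is132 : ∀ {n} → Vec (Fin n) n → Fin n × Fin n × Fin n → Bool
is132 π (i , j , k) =
  ⌊ toℕ i <? toℕ j ⌋ ∧ ⌊ toℕ j <? toℕ k ⌋ ∧
  ⌊ toℕ (lookup π i) <? toℕ (lookup π k) ⌋ ∧ ⌊ toℕ (lookup π k) <? toℕ (lookup π j) ⌋

occ132 : ∀ {n} → Vec (Fin n) n → List (Fin n × Fin n × Fin n)
occ132 {n} π = filter (λ t → T? (is132 π t)) (triples n)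

inA : ∀ {n} (k : ℕ) → Vec (Fin n) n → Bool
inA k π with occ132 π
... | (i , j , l) ∷ [] = isPerm π ∧ ⌊ toℕ l ∸ toℕ j ∸ 1 ≟ k ⌋
... | _ = false

inB : ∀ {m} → Vec (Fin m) m → Bool
inB π with occ132 π
... | (i , j , l) ∷ [] = isPerm π ∧ ⌊ toℕ j ≟ suc (toℕ i) ⌋ ∧ ⌊ toℕ l ≟ suc (toℕ j) ⌋
... | _ = false

inD : ∀ {m} → Vec (Fin m) m → Bool
inD {m} π with occ132 π
... | (i , j , l) ∷ [] = isPerm π ∧ ⌊ toℕ i ≟ 0 ⌋ ∧ ⌊ toℕ j ≟ 1 ⌋ ∧ ⌊ suc (toℕ l) ≟ m ⌋
... | _ = false

SetA : (n k : ℕ) → Set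
SetA n k = Data.Product.Σ (Vec (Fin n) n) (λ π → T (inA k π))

SetB : (m : ℕ) → Set
SetB m = Data.Product.Σ (Vec (Fin m) m) (λ ρ → T (inB ρ))

SetD : (m : ℕ) → Set
SetD m = Data.Product.Σ (Vec (Fin m) m) (λ σ → T (inD σ))

module Submission where

-- Let the unique 132 of π be a c b with the k letters w between c and b. Uniqueness forces c to follow
-- a directly and every letter of w to lie below a; comparing with the letters before a and after b shows
-- that w fills an interval [t, t + k) of values, where t is one more than the largest letter after b
-- that is smaller than a. Deleting w and closing that gap of values gives ρ, whose only 132 is a c b at
-- consecutive positions, and standardizing the factor a c w b gives σ. Since t is read off ρ in the
-- same way, the map is inverted by opening the gap [t, t + k) in ρ and inserting the standardized
-- middle of σ after c; a case analysis on where the letters of a pattern come from shows that this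
-- creates no 132 besides a c b.

open import Defs
open import Data.Nat
open import Data.Nat.Properties
open import Data.Bool using (Bool; true; false; if_then_else_; T; _∧_; _∨_; not)
open import Data.Bool.Properties using (T?; T-∧; T-irrelevant)
open import Data.Empty using (⊥; ⊥-elim)
open import Data.Fin as F using (Fin; toℕ; fromℕ<)
open import Data.Fin.Properties using (toℕ<n; toℕ-fromℕ<; toℕ-injective; punchOut-injective; any?)
open import Function using (_∘_)
open import Function.Bundles using (_⤖_; mk↔ₛ′; Equivalence)
open import Function.Properties.Inverse using (↔⇒⤖)
open import Data.Vec using (Vec; []; _∷_; lookup; tabulate)
open import Data.Vec.Properties using (lookup∘tabulate)
open import Data.List using (List; []; _∷_; filter; concatMap; map; allFin)
open import Data.List.Properties using (filter-none)
open import Data.List.Membership.Propositional using (_∈_; lose; find)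
open import Data.List.Membership.Propositional.Properties
  using (∈-concatMap⁺; ∈-concatMap⁻; ∈-map⁺; ∈-map⁻; ∈-allFin; ∈-filter⁺; ∈-filter⁻)
open import Data.List.Relation.Unary.Any using (here; there)
import Data.List.Relation.Unary.All as All
open import Data.List.Relation.Unary.Unique.Propositional using (Unique)
open import Data.List.Relation.Unary.AllPairs using ([]; _∷_)
import Data.List.Relation.Unary.Unique.Propositional.Properties as Uniqueₚ
open import Data.Product using (Σ; ∃-syntax; _×_; _,_; proj₁; proj₂)
open import Data.Sum using (_⊎_; inj₁; inj₂)
open import Relation.Nullary using (¬_; Dec; yes; no; contradiction)
open import Relation.Nullary.Decidable using (⌊_⌋; toWitness; fromWitness)
open import Relation.Unary using (Decidable)
open import Relation.Binary.Core using (_Preserves_⟶_)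
open import Relation.Binary.Definitions using (tri<; tri≈; tri>)
open import Relation.Binary.PropositionalEquality
open ≡-Reasoning

InjectiveOn : ℕ → (ℕ → ℕ) → Set
InjectiveOn n f = ∀ {p q} → p < n → q < n → f p ≡ f q → p ≡ q

MapsInto : ℕ → (ℕ → ℕ) → Set
MapsInto n f = ∀ {p} → p < n → f p < n

Occ132 : (ℕ → ℕ) → ℕ → ℕ → ℕ → Set
Occ132 f p q r = p < q × q < r × f p < f r × f r < f q

UniqueOcc132 : ℕ → (ℕ → ℕ) → ℕ → ℕ → ℕ → Set
UniqueOcc132 n f i j l =
  Occ132 f i j l × l < n × (∀ {p q r} → r < n → Occ132 f p q r → p ≡ i × q ≡ j × r ≡ l)

if-< : ∀ {A : Set} {m n} {x y : A} → m < n → (if m <ᵇ n then x else y) ≡ x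
if-< {m = m} {n} m<n with m <ᵇ n | <⇒<ᵇ m<n
... | true | _ = refl

if-≥ : ∀ {A : Set} {m n} {x y : A} → n ≤ m → (if m <ᵇ n then x else y) ≡ y
if-≥ {m = m} {n} n≤m with m <ᵇ n in m<ᵇn
... | true = contradiction n≤m (<⇒≱ (<ᵇ⇒< m n (subst T (sym m<ᵇn) _)))
... | false = refl

+-<-∸ : ∀ {x n} s → x < n ∸ s → s + x < n
+-<-∸ {x} {n} s x<n∸s = subst (s + x <_) (m+[n∸m]≡n s≤n) (+-monoʳ-< s x<n∸s)
  where
  s≤n : s ≤ n
  s≤n = <⇒≤ (m∸n≢0⇒n<m (λ e → <⇒≱ x<n∸s (subst (_≤ x) (sym e) z≤n)))

strictMono⇒injective : ∀ {e : ℕ → ℕ} → e Preserves _<_ ⟶ _<_ → ∀ {p q} → e p ≡ e q → p ≡ q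
strictMono⇒injective mono {p} {q} ep≡eq with <-cmp p q
... | tri< p<q _ _ = contradiction ep≡eq (<⇒≢ (mono p<q))
... | tri≈ _ p≡q _ = p≡q
... | tri> _ _ q<p = contradiction (sym ep≡eq) (<⇒≢ (mono q<p))

strictMono⇒reflects-< : ∀ {e : ℕ → ℕ} → e Preserves _<_ ⟶ _<_ → ∀ {p q} → e p < e q → p < q
strictMono⇒reflects-< mono {p} {q} ep<eq with <-cmp p q
... | tri< p<q _ _ = p<q
... | tri≈ _ refl _ = contradiction ep<eq (<-irrefl refl)
... | tri> _ _ q<p = contradiction ep<eq (<-asym (mono q<p))

injectiveOn⇒≤ : ∀ {K L} (g : ℕ → ℕ) → (∀ {x} → x < K → g x < L) → InjectiveOn K g → K ≤ L
injectiveOn⇒≤ {K} {L} g bounded inj = Data.Fin.Properties.injective⇒≤ G-injective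
  where
  G : Fin K → Fin L
  G x = fromℕ< (bounded (toℕ<n x))
  G-injective : ∀ {x y} → G x ≡ G y → x ≡ y
  G-injective {x} {y} e = toℕ-injective (inj (toℕ<n x) (toℕ<n y)
    (trans (sym (toℕ-fromℕ< _)) (trans (cong toℕ e) (toℕ-fromℕ< _))))

-- a missed value could be punched out, injecting Fin (suc n) into Fin n
injectiveOn⇒surjectiveOn : ∀ {n f} → MapsInto n f → InjectiveOn n f →
  ∀ {v} → v < n → ∃[ p ] p < n × f p ≡ v
injectiveOn⇒surjectiveOn {suc n} {f} into inj {v} v<n with any? (λ (x : Fin (suc n)) → f (toℕ x) ≟ v)
... | yes (x , fx≡v) = toℕ x , toℕ<n x , fx≡v
... | no missed = contradiction (Data.Fin.Properties.injective⇒≤ G-injective) 1+n≰n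
  where
  F : Fin (suc n) → Fin (suc n)
  F x = fromℕ< (into (toℕ<n x))
  avoids : ∀ x → fromℕ< v<n ≢ F x
  avoids x e = missed (x , trans (sym (toℕ-fromℕ< _)) (trans (cong toℕ (sym e)) (toℕ-fromℕ< v<n)))
  G : Fin (suc n) → Fin n
  G x = F.punchOut (avoids x)
  G-injective : ∀ {x y} → G x ≡ G y → x ≡ y
  G-injective {x} {y} e = toℕ-injective (inj (toℕ<n x) (toℕ<n y)
    (trans (sym (toℕ-fromℕ< _)) (trans (cong toℕ (punchOut-injective (avoids x) (avoids y) e)) (toℕ-fromℕ< _))))

uniqueOcc132-adjacent : ∀ {N f i j l} → InjectiveOn N f → UniqueOcc132 N f i j l → j ≡ suc i
uniqueOcc132-adjacent {N} {f} {i} {j} {l} f-inj ((i<j , j<l , fi<fl , fl<fj) , l<N , only) with m≤n⇒m<n∨m≡n i<j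
... | inj₂ 1+i≡j = sym 1+i≡j
... | inj₁ 1+i<j with <-cmp (f (suc i)) (f l)
...   | tri< f1+i<fl _ _ = contradiction (proj₁ (only l<N (1+i<j , j<l , f1+i<fl , fl<fj))) (>⇒≢ (n<1+n i))
...   | tri≈ _ f1+i≡fl _ = contradiction (f-inj (<-trans 1+i<j (<-trans j<l l<N)) l<N f1+i≡fl) (<⇒≢ (<-trans 1+i<j j<l))
...   | tri> _ _ fl<f1+i = contradiction (proj₁ (proj₂ (only l<N (n<1+n i , <-trans 1+i<j j<l , fi<fl , fl<f1+i)))) (<⇒≢ 1+i<j)

module Restriction {len N : ℕ} (f e φ : ℕ → ℕ) (V : ℕ → Set)
  (e-mono : e Preserves _<_ ⟶ _<_) (e-into : ∀ {p} → p < len → e p < N)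
  (f∘e∈V : ∀ {p} → p < len → V (f (e p)))
  (φ-mono : ∀ {u v} → V u → V v → u < v → φ u < φ v)
  (f-inj : InjectiveOn N f) where

  g : ℕ → ℕ
  g p = φ (f (e p))

  preserves : ∀ {p q} → p < len → q < len → f (e p) < f (e q) → g p < g q
  preserves p<len q<len = φ-mono (f∘e∈V p<len) (f∘e∈V q<len)

  reflects : ∀ {p q} → p < len → q < len → g p < g q → f (e p) < f (e q)
  reflects {p} {q} p<len q<len gp<gq with <-cmp (f (e p)) (f (e q))
  ... | tri< lt _ _ = lt
  ... | tri≈ _ eq _ = contradiction gp<gq (<-irrefl (cong φ eq))
  ... | tri> _ _ gt = contradiction gp<gq (<-asym (preserves q<len p<len gt))

  injective : InjectiveOn len g
  injective {p} {q} p<len q<len gp≡gq with <-cmp (f (e p)) (f (e q))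
  ... | tri< lt _ _ = contradiction gp≡gq (<⇒≢ (preserves p<len q<len lt))
  ... | tri≈ _ eq _ = strictMono⇒injective e-mono (f-inj (e-into p<len) (e-into q<len) eq)
  ... | tri> _ _ gt = contradiction (sym gp≡gq) (<⇒≢ (preserves q<len p<len gt))

  occ-down : ∀ {p q r} → r < len → Occ132 g p q r → Occ132 f (e p) (e q) (e r)
  occ-down r<len (p<q , q<r , gp<gr , gr<gq) =
    e-mono p<q , e-mono q<r , reflects p<len r<len gp<gr , reflects r<len q<len gr<gq
    where
    q<len = <-trans q<r r<len
    p<len = <-trans p<q q<len

  unique-occ : ∀ {I J L i j l} → UniqueOcc132 N f I J L → e i ≡ I → e j ≡ J → e l ≡ L →
    i < j → j < l → l < len → UniqueOcc132 len g i j l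
  unique-occ {I} {J} {L} {i} {j} {l} ((_ , _ , fI<fL , fL<fJ) , _ , only) refl refl refl i<j j<l l<len =
    (i<j , j<l , preserves i<len l<len fI<fL , preserves l<len j<len fL<fJ) , l<len , only′
    where
    j<len = <-trans j<l l<len
    i<len = <-trans i<j j<len
    only′ : ∀ {p q r} → r < len → Occ132 g p q r → p ≡ i × q ≡ j × r ≡ l
    only′ r<len o with only (e-into r<len) (occ-down r<len o)
    ... | p≡ , q≡ , r≡ = strictMono⇒injective e-mono p≡ , strictMono⇒injective e-mono q≡ ,
                         strictMono⇒injective e-mono r≡

succIfBelow : ℕ → ℕ → ℕ
succIfBelow v A = if v <ᵇ A then suc v else 0

succMaxBelow : (ℕ → ℕ) → ℕ → ℕ → ℕ
succMaxBelow g A zero = 0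
succMaxBelow g A (suc c) = succIfBelow (g c) A ⊔ succMaxBelow g A c

succMaxBelow-ub : ∀ g A c {x} → x < c → g x < A → g x < succMaxBelow g A c
succMaxBelow-ub g A (suc c) {x} x<1+c gx<A with m≤n⇒m<n∨m≡n (s≤s⁻¹ x<1+c)
... | inj₁ x<c = <-≤-trans (succMaxBelow-ub g A c x<c gx<A) (m≤n⊔m (succIfBelow (g c) A) _)
... | inj₂ refl = subst (λ w → g x < w ⊔ succMaxBelow g A x) (sym (if-< gx<A)) (m≤m⊔n (suc (g x)) (succMaxBelow g A x))

succMaxBelow-attained : ∀ g A c →
  succMaxBelow g A c ≡ 0 ⊎ ∃[ x ] x < c × g x < A × succMaxBelow g A c ≡ suc (g x)
succMaxBelow-attained g A zero = inj₁ refl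
succMaxBelow-attained g A (suc c) with g c <ᵇ A in gc<ᵇA | succMaxBelow-attained g A c
... | false | inj₁ e = inj₁ e
... | false | inj₂ (x , x<c , gx<A , e) = inj₂ (x , m<n⇒m<1+n x<c , gx<A , e)
... | true | inj₁ e = inj₂ (c , ≤-refl , <ᵇ⇒< _ _ (subst T (sym gc<ᵇA) _) , cong (suc (g c) ⊔_) e)
... | true | inj₂ (x , x<c , gx<A , e) with ⊔-sel (suc (g c)) (succMaxBelow g A c)
...   | inj₁ e′ = inj₂ (c , ≤-refl , <ᵇ⇒< _ _ (subst T (sym gc<ᵇA) _) , e′)
...   | inj₂ e′ = inj₂ (x , m<n⇒m<1+n x<c , gx<A , trans e′ e)

succMaxBelow-≤ : ∀ g A c → succMaxBelow g A c ≤ A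
succMaxBelow-≤ g A c with succMaxBelow-attained g A c
... | inj₁ e = subst (_≤ A) (sym e) z≤n
... | inj₂ (_ , _ , gx<A , e) = subst (_≤ A) (sym e) gx<A

succMaxBelow-cong : ∀ g g′ A A′ c → (∀ {x} → x < c → succIfBelow (g x) A ≡ succIfBelow (g′ x) A′) →
  succMaxBelow g A c ≡ succMaxBelow g′ A′ c
succMaxBelow-cong g g′ A A′ zero eq = refl
succMaxBelow-cong g g′ A A′ (suc c) eq =
  cong₂ _⊔_ (eq ≤-refl) (succMaxBelow-cong g g′ A A′ c (λ x<c → eq (m<n⇒m<1+n x<c)))

-- 1 + the largest letter after position P that is smaller than f i, or 0 if there is none
threshold : (ℕ → ℕ) → ℕ → ℕ → ℕ → ℕ
threshold f i P n = succMaxBelow (λ x → f (suc P + x)) (f i) (n ∸ suc P)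

threshold-ub : ∀ f i {P n q} → P < q → q < n → f q < f i → f q < threshold f i P n
threshold-ub f i {P} {n} {q} P<q q<n fq<fi =
  subst (λ r → f r < threshold f i P n) shift
    (succMaxBelow-ub _ (f i) (n ∸ suc P) (∸-monoˡ-< q<n P<q) (subst (λ r → f r < f i) (sym shift) fq<fi))
  where
  shift : suc P + (q ∸ suc P) ≡ q
  shift = m+[n∸m]≡n P<q

threshold-attained : ∀ f i P n → threshold f i P n ≡ 0 ⊎
  ∃[ q ] P < q × q < n × f q < f i × threshold f i P n ≡ suc (f q)
threshold-attained f i P n with succMaxBelow-attained (λ x → f (suc P + x)) (f i) (n ∸ suc P)
... | inj₁ e = inj₁ e
... | inj₂ (x , x<n∸1+P , lt , e) = inj₂ (suc P + x , s≤s (m≤m+n P x) , +-<-∸ (suc P) x<n∸1+P , lt , e)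

threshold-≤ : ∀ f i P n → threshold f i P n ≤ f i
threshold-≤ f i P n = succMaxBelow-≤ _ (f i) (n ∸ suc P)

middle : ℕ → ℕ → ℕ
middle i x = suc (suc (i + x))

i<middle : ∀ i x → i < middle i x
i<middle i x = s≤s (m≤n⇒m≤1+n (m≤m+n i x))

1+i<middle : ∀ i x → suc i < middle i x
1+i<middle i x = s≤s (s≤s (m≤m+n i x))

middle-mono : ∀ i {x y} → x < y → middle i x < middle i y
middle-mono i x<y = s≤s (s≤s (+-monoʳ-< i x<y))

middle-injective : ∀ i {x y} → middle i x ≡ middle i y → x ≡ y
middle-injective i e = +-cancelˡ-≡ i _ _ (cong (λ z → pred (pred z)) e)

i+2+y≡middle : ∀ i y → i + suc (suc y) ≡ middle i y
i+2+y≡middle i y = trans (+-suc i (suc y)) (cong suc (+-suc i y))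

k+3≡3+k : ∀ k → k + 3 ≡ suc (suc (suc k))
k+3≡3+k k = +-comm k 3

2+y<k+3 : ∀ {y k} → y < k → suc (suc y) < k + 3
2+y<k+3 {y} {k} y<k = subst (suc (suc y) <_) (sym (k+3≡3+k k)) (s≤s (s≤s (m<n⇒m<1+n y<k)))

middle<first : ∀ {N f i k x} → InjectiveOn N f → UniqueOcc132 N f i (suc i) (middle i k) → x < k →
  f (middle i x) < f i
middle<first {N} {f} {i} {k} {x} f-inj ((_ , _ , a<b , b<c) , L<N , only) x<k with <-cmp (f (middle i x)) (f (middle i k))
... | tri> _ _ b<fx =
  contradiction (proj₁ (proj₂ (only L<N (i<middle i x , middle-mono i x<k , a<b , b<fx)))) (>⇒≢ (1+i<middle i x))
... | tri≈ _ fx≡b _ = contradiction (f-inj x<N L<N fx≡b) (<⇒≢ (middle-mono i x<k))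
  where x<N = <-trans (middle-mono i x<k) L<N
... | tri< fx<b _ _ with <-cmp (f (middle i x)) (f i)
...   | tri< fx<a _ _ = fx<a
...   | tri≈ _ fx≡a _ =
  contradiction (f-inj (<-trans (middle-mono i x<k) L<N) (<-trans (i<middle i k) L<N) fx≡a) (>⇒≢ (i<middle i x))
...   | tri> _ _ a<fx =
  contradiction (proj₂ (proj₂ (only (<-trans (middle-mono i x<k) L<N) (n<1+n i , 1+i<middle i x , a<fx , <-trans fx<b b<c))))
    (<⇒≢ (middle-mono i x<k))

i+x≤middle : ∀ {i k x} → x < k + 3 → i + x ≤ middle i k
i+x≤middle {i} {k} {x} x<k+3 =
  subst (i + x ≤_) (i+2+y≡middle i k) (+-monoʳ-≤ i (s≤s⁻¹ (subst (x <_) (k+3≡3+k k) x<k+3)))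

data Position (i k p : ℕ) : Set where
  before : p < i → Position i k p
  atA : p ≡ i → Position i k p
  atC : p ≡ suc i → Position i k p
  inside : ∀ x → x < k → p ≡ middle i x → Position i k p
  atB : p ≡ middle i k → Position i k p
  after : middle i k < p → Position i k p

position : ∀ i k p → Position i k p
position i k p with <-cmp p i
... | tri< p<i _ _ = before p<i
... | tri≈ _ p≡i _ = atA p≡i
... | tri> _ _ i<p with <-cmp p (suc i)
...   | tri< p<1+i _ _ = contradiction i<p (≤⇒≯ (s≤s⁻¹ p<1+i))
...   | tri≈ _ p≡1+i _ = atC p≡1+i
...   | tri> _ _ 1+i<p with <-cmp p (middle i k)
...     | tri< p<L _ _ = inside (p ∸ suc (suc i)) x<k (sym (m+[n∸m]≡n 1+i<p))
  where
  x<k : p ∸ suc (suc i) < k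
  x<k = subst (p ∸ suc (suc i) <_) (m+n∸m≡n (suc (suc i)) k) (∸-monoˡ-< p<L 1+i<p)
...     | tri≈ _ p≡L _ = atB p≡L
...     | tri> _ _ L<p = after L<p

InBlock : ℕ → ℕ → ℕ → Set
InBlock t k v = t ≤ v × v < t + k

Outside : ℕ → ℕ → ℕ → Set
Outside t k v = v < t ⊎ t + k ≤ v

collapse : ℕ → ℕ → ℕ → ℕ
collapse t k v = if v <ᵇ t then v else v ∸ k

expand : ℕ → ℕ → ℕ → ℕ
expand t k v = if v <ᵇ t then v else v + k

collapse-mono : ∀ {t k u v} → Outside t k u → Outside t k v → u < v → collapse t k u < collapse t k v
collapse-mono {t} (inj₁ u<t) (inj₁ v<t) u<v = subst₂ _<_ (sym (if-< u<t)) (sym (if-< v<t)) u<v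
collapse-mono {t} {k} {u} {v} (inj₁ u<t) (inj₂ t+k≤v) u<v =
  subst₂ _<_ (sym (if-< u<t)) (sym (if-≥ (m+n≤o⇒m≤o t t+k≤v))) (<-≤-trans u<t (m+n≤o⇒m≤o∸n t t+k≤v))
collapse-mono {t} (inj₂ t+k≤u) (inj₁ v<t) u<v = contradiction (<-trans u<v v<t) (≤⇒≯ (m+n≤o⇒m≤o t t+k≤u))
collapse-mono {t} {k} (inj₂ t+k≤u) (inj₂ t+k≤v) u<v =
  subst₂ _<_ (sym (if-≥ (m+n≤o⇒m≤o t t+k≤u))) (sym (if-≥ (m+n≤o⇒m≤o t t+k≤v)))
    (∸-monoˡ-< u<v (m+n≤o⇒n≤o t t+k≤u))

expand-mono : ∀ {t k} → expand t k Preserves _<_ ⟶ _<_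
expand-mono {t} {k} {u} {v} u<v with u <? t | v <? t
... | yes u<t | yes v<t = subst₂ _<_ (sym (if-< u<t)) (sym (if-< v<t)) u<v
... | yes u<t | no v≮t = subst₂ _<_ (sym (if-< u<t)) (sym (if-≥ (≮⇒≥ v≮t))) (<-≤-trans u<v (m≤m+n v k))
... | no u≮t | yes v<t = contradiction (<-trans u<v v<t) u≮t
... | no u≮t | no v≮t = subst₂ _<_ (sym (if-≥ (≮⇒≥ u≮t))) (sym (if-≥ (≮⇒≥ v≮t))) (+-monoˡ-< k u<v)

expand-outside : ∀ t k v → Outside t k (expand t k v)
expand-outside t k v with v <? t
... | yes v<t = inj₁ (subst (_< t) (sym (if-< v<t)) v<t)
... | no v≮t = inj₂ (subst (t + k ≤_) (sym (if-≥ (≮⇒≥ v≮t))) (+-monoˡ-≤ k (≮⇒≥ v≮t)))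

expand-≥ : ∀ t k v → v ≤ expand t k v
expand-≥ t k v with v <? t
... | yes v<t = ≤-reflexive (sym (if-< v<t))
... | no v≮t = subst (v ≤_) (sym (if-≥ (≮⇒≥ v≮t))) (m≤m+n v k)

expand-≤ : ∀ t k v → expand t k v ≤ v + k
expand-≤ t k v with v <? t
... | yes v<t = subst (_≤ v + k) (sym (if-< v<t)) (m≤m+n v k)
... | no v≮t = ≤-reflexive (if-≥ (≮⇒≥ v≮t))

expand-reflects-≥ : ∀ {t k v} → t ≤ expand t k v → t ≤ v
expand-reflects-≥ {t} {k} {v} t≤ with v <? t
... | yes v<t = contradiction (subst (t ≤_) (if-< v<t) t≤) (<⇒≱ v<t)
... | no v≮t = ≮⇒≥ v≮t

expand∘collapse : ∀ {t k v} → Outside t k v → expand t k (collapse t k v) ≡ v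
expand∘collapse {t} {k} {v} (inj₁ v<t) = trans (cong (expand t k) (if-< {y = v ∸ k} v<t)) (if-< v<t)
expand∘collapse {t} {k} {v} (inj₂ t+k≤v) =
  trans (cong (expand t k) (if-≥ {x = v} (m+n≤o⇒m≤o t t+k≤v)))
    (trans (if-≥ (m+n≤o⇒m≤o∸n t t+k≤v)) (m∸n+n≡m (m+n≤o⇒n≤o t t+k≤v)))

collapse∘expand : ∀ t k v → collapse t k (expand t k v) ≡ v
collapse∘expand t k v with v <? t
... | yes v<t = trans (cong (collapse t k) (if-< v<t)) (if-< v<t)
... | no v≮t = trans (cong (collapse t k) (if-≥ (≮⇒≥ v≮t)))
                 (trans (if-≥ (≤-trans (≮⇒≥ v≮t) (m≤m+n v k))) (m+n∸n≡m v k))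

-- the position in π of position p of ρ, i.e. of π with the k letters between c and b removed
skipWindow : ℕ → ℕ → ℕ → ℕ
skipWindow i k p = if p <ᵇ suc (suc i) then p else p + k

skipWindow-mono : ∀ {i k} → skipWindow i k Preserves _<_ ⟶ _<_
skipWindow-mono {i} {k} {p} {q} p<q with p <? suc (suc i) | q <? suc (suc i)
... | yes p<2+i | yes q<2+i = subst₂ _<_ (sym (if-< p<2+i)) (sym (if-< q<2+i)) p<q
... | yes p<2+i | no q≮2+i =
  subst₂ _<_ (sym (if-< p<2+i)) (sym (if-≥ (≮⇒≥ q≮2+i))) (<-≤-trans p<q (m≤m+n q k))
... | no p≮2+i | yes q<2+i = contradiction (<-trans p<q q<2+i) p≮2+i
... | no p≮2+i | no q≮2+i =
  subst₂ _<_ (sym (if-≥ (≮⇒≥ p≮2+i))) (sym (if-≥ (≮⇒≥ q≮2+i))) (+-monoˡ-< k p<q)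

skipWindow-side : ∀ i k p →
  (p < suc (suc i) × skipWindow i k p ≡ p) ⊎ (suc (suc i) ≤ p × skipWindow i k p ≡ p + k)
skipWindow-side i k p with p <? suc (suc i)
... | yes p<2+i = inj₁ (p<2+i , if-< p<2+i)
... | no p≮2+i = inj₂ (≮⇒≥ p≮2+i , if-≥ (≮⇒≥ p≮2+i))

skipWindow-< : ∀ {i k m p} → p < m → skipWindow i k p < m + k
skipWindow-< {i} {k} {m} {p} p<m with skipWindow-side i k p
... | inj₁ (_ , e) = subst (_< m + k) (sym e) (<-≤-trans p<m (m≤m+n m k))
... | inj₂ (_ , e) = subst (_< m + k) (sym e) (+-monoˡ-< k p<m)

skipWindow-≢middle : ∀ i k p {x} → x < k → skipWindow i k p ≢ middle i x
skipWindow-≢middle i k p {x} x<k e with skipWindow-side i k p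
... | inj₁ (p<2+i , s≡p) = <⇒≢ (<-≤-trans p<2+i (1+i<middle i x)) (trans (sym s≡p) e)
... | inj₂ (2+i≤p , s≡p+k) =
  <⇒≢ (<-≤-trans (middle-mono i x<k) (+-monoˡ-≤ k 2+i≤p)) (sym (trans (sym s≡p+k) e))

skipWindow<middle : ∀ {i k p y} → y < k → skipWindow i k p < middle i y → p < suc (suc i) × skipWindow i k p ≡ p
skipWindow<middle {i} {k} {p} y<k lt with skipWindow-side i k p
... | inj₁ side = side
... | inj₂ (2+i≤p , e) =
  contradiction (subst (_< middle i _) e lt) (≤⇒≯ (≤-trans (<⇒≤ (middle-mono i y<k)) (+-monoˡ-≤ k 2+i≤p)))

middle<skipWindow : ∀ {i k p y} → middle i y < skipWindow i k p → suc (suc i) ≤ p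
middle<skipWindow {i} {k} {p} {y} lt with skipWindow-side i k p
... | inj₂ (2+i≤p , _) = 2+i≤p
... | inj₁ (p<2+i , e) = ⊥-elim (<⇒≱ (<-trans lt (subst (_< suc (suc i)) (sym e) p<2+i)) (1+i<middle i y))

threshold-after-window : ∀ {g f i k m} →
  (∀ {q} → suc (suc i) < q → q < m → succIfBelow (g q) (g i) ≡ succIfBelow (f (q + k)) (f i)) →
  threshold g i (suc (suc i)) m ≡ threshold f i (middle i k) (m + k)
threshold-after-window {g} {f} {i} {k} {m} agree =
  trans (succMaxBelow-cong _ _ (g i) (f i) (m ∸ suc (suc (suc i))) pointwise) (cong (succMaxBelow _ (f i)) (sym count))
  where
  count : (m + k) ∸ suc (middle i k) ≡ m ∸ suc (suc (suc i))
  count = trans (cong₂ _∸_ (+-comm m k) (+-comm (suc (suc (suc i))) k)) ([m+n]∸[m+o]≡n∸o k m (suc (suc (suc i))))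
  shift : ∀ x → suc (suc (suc i)) + x + k ≡ suc (middle i k) + x
  shift x = cong (λ z → suc (suc (suc z))) (trans (+-assoc i x k) (trans (cong (i +_) (+-comm x k)) (sym (+-assoc i k x))))
  pointwise : ∀ {x} → x < m ∸ suc (suc (suc i)) →
    succIfBelow (g (suc (suc (suc i)) + x)) (g i) ≡ succIfBelow (f (suc (middle i k) + x)) (f i)
  pointwise {x} x<c = trans (agree (m≤m+n (suc (suc (suc i))) x) (+-<-∸ (suc (suc (suc i))) x<c))
    (cong (λ q → succIfBelow (f q) (f i)) (shift x))

succIfBelow-collapse : ∀ {t k a v} → t + k ≤ a → Outside t k v → (v < a → v < t) →
  succIfBelow (collapse t k v) (a ∸ k) ≡ succIfBelow v a
succIfBelow-collapse {t} {k} {a} {v} t+k≤a (inj₁ v<t) _ =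
  trans (cong (λ w → succIfBelow w (a ∸ k)) (if-< {y = v ∸ k} v<t))
    (trans (if-< (<-≤-trans v<t (m+n≤o⇒m≤o∸n t t+k≤a))) (sym (if-< (<-≤-trans v<t (m+n≤o⇒m≤o t t+k≤a)))))
succIfBelow-collapse {t} {k} {a} {v} t+k≤a (inj₂ t+k≤v) below-t with v <? a
... | yes v<a = contradiction (below-t v<a) (≤⇒≯ (m+n≤o⇒m≤o t t+k≤v))
... | no v≮a = trans (cong (λ w → succIfBelow w (a ∸ k)) (if-≥ {x = v} (m+n≤o⇒m≤o t t+k≤v)))
    (trans (if-≥ (∸-monoˡ-≤ k (≮⇒≥ v≮a))) (sym (if-≥ (≮⇒≥ v≮a))))

succIfBelow-expand : ∀ {t k a v} → t ≤ a → (v < a → v < t) → succIfBelow (expand t k v) (a + k) ≡ succIfBelow v a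
succIfBelow-expand {t} {k} {a} {v} t≤a below-t with v <? t
... | yes v<t = trans (cong (λ w → succIfBelow w (a + k)) (if-< {y = v + k} v<t))
    (trans (if-< (<-≤-trans v<t (≤-trans t≤a (m≤m+n a k)))) (sym (if-< (<-≤-trans v<t t≤a))))
... | no v≮t with v <? a
...   | yes v<a = contradiction (below-t v<a) v≮t
...   | no v≮a = trans (cong (λ w → succIfBelow w (a + k)) (if-≥ {x = v} (≮⇒≥ v≮t)))
    (trans (if-≥ (+-monoˡ-≤ k (≮⇒≥ v≮a))) (sym (if-≥ (≮⇒≥ v≮a))))

-- standardizes the factor a c w b of π: the letters of w, which fill [t, t + k), go to [0, k) and a , b , c to k , k+1 , k+2
windowStd : ℕ → ℕ → ℕ → ℕ → ℕ → ℕ → ℕ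
windowStd t k a b c v =
  if v <ᵇ a then v ∸ t else (if v <ᵇ b then k else (if v <ᵇ c then suc k else suc (suc k)))

InWindow : ℕ → ℕ → ℕ → ℕ → ℕ → ℕ → Set
InWindow t k a b c v = InBlock t k v ⊎ v ≡ a ⊎ v ≡ b ⊎ v ≡ c

module WindowStd {t k a b c : ℕ} (t+k≤a : t + k ≤ a) (a<b : a < b) (b<c : b < c) where

  ws : ℕ → ℕ
  ws = windowStd t k a b c

  a<c : a < c
  a<c = <-trans a<b b<c

  block<a : ∀ {v} → InBlock t k v → v < a
  block<a (_ , v<t+k) = <-≤-trans v<t+k t+k≤a

  ws-block : ∀ {v} → InBlock t k v → ws v ≡ v ∸ t
  ws-block v∈ = if-< (block<a v∈)

  ws-block<k : ∀ {v} → InBlock t k v → ws v < k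
  ws-block<k {v} v∈@(t≤v , v<t+k) =
    subst (_< k) (sym (ws-block v∈)) (subst (v ∸ t <_) (m+n∸m≡n t k) (∸-monoˡ-< v<t+k t≤v))

  ws-a : ws a ≡ k
  ws-a = trans (if-≥ (≤-refl {a})) (if-< a<b)

  ws-b : ws b ≡ suc k
  ws-b = trans (if-≥ (<⇒≤ a<b)) (trans (if-≥ (≤-refl {b})) (if-< b<c))

  ws-c : ws c ≡ suc (suc k)
  ws-c = trans (if-≥ (<⇒≤ a<c)) (trans (if-≥ (<⇒≤ b<c)) (if-≥ (≤-refl {c})))

  ws-≤k : ∀ {v} → InBlock t k v ⊎ v ≡ a → ws v ≤ k
  ws-≤k (inj₁ v∈) = <⇒≤ (ws-block<k v∈)
  ws-≤k (inj₂ refl) = ≤-reflexive ws-a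

  ws-≤1+k : ∀ {v} → InBlock t k v ⊎ v ≡ a ⊎ v ≡ b → ws v ≤ suc k
  ws-≤1+k (inj₁ v∈) = m≤n⇒m≤1+n (ws-≤k (inj₁ v∈))
  ws-≤1+k (inj₂ (inj₁ refl)) = m≤n⇒m≤1+n (ws-≤k (inj₂ refl))
  ws-≤1+k (inj₂ (inj₂ refl)) = ≤-reflexive ws-b

  ws-≤2+k : ∀ {v} → InWindow t k a b c v → ws v ≤ suc (suc k)
  ws-≤2+k (inj₂ (inj₂ (inj₂ refl))) = ≤-reflexive ws-c
  ws-≤2+k (inj₁ v∈) = m≤n⇒m≤1+n (ws-≤1+k (inj₁ v∈))
  ws-≤2+k (inj₂ (inj₁ refl)) = m≤n⇒m≤1+n (ws-≤1+k (inj₂ (inj₁ refl)))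
  ws-≤2+k (inj₂ (inj₂ (inj₁ refl))) = m≤n⇒m≤1+n (ws-≤1+k (inj₂ (inj₂ refl)))

  below-a : ∀ {u} → InWindow t k a b c u → u < a → InBlock t k u
  below-a (inj₁ u∈) _ = u∈
  below-a (inj₂ (inj₁ refl)) u<a = contradiction u<a (<-irrefl refl)
  below-a (inj₂ (inj₂ (inj₁ refl))) u<a = contradiction u<a (<-asym a<b)
  below-a (inj₂ (inj₂ (inj₂ refl))) u<a = contradiction u<a (<-asym a<c)

  below-b : ∀ {u} → InWindow t k a b c u → u < b → InBlock t k u ⊎ u ≡ a
  below-b (inj₂ (inj₁ u≡a)) _ = inj₂ u≡a
  below-b (inj₂ (inj₂ (inj₁ refl))) u<b = contradiction u<b (<-irrefl refl)
  below-b (inj₂ (inj₂ (inj₂ refl))) u<b = contradiction u<b (<-asym b<c)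
  below-b (inj₁ u∈) _ = inj₁ u∈

  below-c : ∀ {u} → InWindow t k a b c u → u < c → InBlock t k u ⊎ u ≡ a ⊎ u ≡ b
  below-c (inj₂ (inj₂ (inj₂ refl))) u<c = contradiction u<c (<-irrefl refl)
  below-c (inj₁ u∈) _ = inj₁ u∈
  below-c (inj₂ (inj₁ u≡a)) _ = inj₂ (inj₁ u≡a)
  below-c (inj₂ (inj₂ (inj₁ u≡b))) _ = inj₂ (inj₂ u≡b)

  ws-mono : ∀ {u v} → InWindow t k a b c u → InWindow t k a b c v → u < v → ws u < ws v
  ws-mono {u} {v} u∈ (inj₁ v∈@(t≤v , _)) u<v with below-a u∈ (<-trans u<v (block<a v∈))
  ... | u∈′@(t≤u , _) = subst₂ _<_ (sym (ws-block u∈′)) (sym (ws-block v∈)) (∸-monoˡ-< u<v t≤u)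
  ws-mono {u} u∈ (inj₂ (inj₁ refl)) u<a = subst (ws u <_) (sym ws-a) (ws-block<k (below-a u∈ u<a))
  ws-mono {u} u∈ (inj₂ (inj₂ (inj₁ refl))) u<b = subst (ws u <_) (sym ws-b) (s≤s (ws-≤k (below-b u∈ u<b)))
  ws-mono {u} u∈ (inj₂ (inj₂ (inj₂ refl))) u<c = subst (ws u <_) (sym ws-c) (s≤s (ws-≤1+k (below-c u∈ u<c)))

insertWindow : (ℕ → ℕ) → (ℕ → ℕ) → ℕ → ℕ → ℕ → ℕ → ℕ
insertWindow h s i k t p =
  if p <ᵇ suc (suc i) then expand t k (h p)
  else (if p <ᵇ middle i k then s (p ∸ i) + t else expand t k (h (p ∸ k)))

insertWindow-skip : ∀ h s i k t p → insertWindow h s i k t (skipWindow i k p) ≡ expand t k (h p)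
insertWindow-skip h s i k t p with skipWindow-side i k p
... | inj₁ (p<2+i , e) rewrite e = if-< p<2+i
... | inj₂ (2+i≤p , e) rewrite e =
  trans (if-≥ (≤-trans 2+i≤p (m≤m+n p k)))
    (trans (if-≥ (+-monoˡ-≤ k 2+i≤p)) (cong (λ q → expand t k (h q)) (m+n∸n≡m p k)))

insertWindow-middle : ∀ h s i k t {y} → y < k → insertWindow h s i k t (middle i y) ≡ s (suc (suc y)) + t
insertWindow-middle h s i k t {y} y<k =
  trans (if-≥ (1+i<middle i y))
    (trans (if-< (middle-mono i y<k))
      (cong (λ q → s q + t) (trans (cong (_∸ i) (sym (i+2+y≡middle i y))) (m+n∸m≡n i (suc (suc y))))))

data Source (m i k p : ℕ) : Set where
  outer : ∀ p′ → p′ < m → p ≡ skipWindow i k p′ → Source m i k p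
  inner : ∀ y → y < k → p ≡ middle i y → Source m i k p

source : ∀ {m i k p} → suc (suc i) < m → p < m + k → Source m i k p
source {m} {i} {k} {p} 2+i<m p<m+k with p <? suc (suc i) | p <? middle i k
... | yes p<2+i | _ = outer p (<-trans p<2+i 2+i<m) (sym (if-< p<2+i))
... | no p≮2+i | yes p<L =
  inner (p ∸ suc (suc i)) (subst (p ∸ suc (suc i) <_) (m+n∸m≡n (suc (suc i)) k) (∸-monoˡ-< p<L 2+i≤p))
    (sym (m+[n∸m]≡n 2+i≤p))
  where 2+i≤p = ≮⇒≥ p≮2+i
... | no _ | no p≮L = outer (p ∸ k) p∸k<m (trans (sym (m∸n+n≡m k≤p)) (sym (if-≥ 2+i≤p∸k)))
  where
  L≤p = ≮⇒≥ p≮L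
  k≤p : k ≤ p
  k≤p = ≤-trans (m≤n+m k (suc (suc i))) L≤p
  2+i≤p∸k : suc (suc i) ≤ p ∸ k
  2+i≤p∸k = subst (_≤ p ∸ k) (m+n∸n≡m (suc (suc i)) k) (∸-monoˡ-≤ k L≤p)
  p∸k<m : p ∸ k < m
  p∸k<m = subst (p ∸ k <_) (m+n∸n≡m m k) (∸-monoˡ-< p<m+k k≤p)

outside-block : ∀ {t k v} → Outside t k v → InBlock t k v → ⊥
outside-block (inj₁ v<t) (t≤v , _) = <⇒≱ v<t t≤v
outside-block (inj₂ t+k≤v) (_ , v<t+k) = <⇒≱ v<t+k t+k≤v

-- Splitting π into ρ and σ

outerPart : (ℕ → ℕ) → ℕ → ℕ → ℕ → ℕ → ℕ
outerPart f i k t p = collapse t k (f (skipWindow i k p))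

windowPart : (ℕ → ℕ) → ℕ → ℕ → ℕ → ℕ → ℕ
windowPart f i k t x = windowStd t k (f i) (f (middle i k)) (f (suc i)) (f (i + x))

module Forward (m k : ℕ) (f : ℕ → ℕ) (i : ℕ)
  (f-inj : InjectiveOn (m + k) f) (f-into : MapsInto (m + k) f)
  (f-occ : UniqueOcc132 (m + k) f i (suc i) (middle i k)) where

  n L a b c t : ℕ
  n = m + k
  L = middle i k
  a = f i
  b = f L
  c = f (suc i)
  t = threshold f i L n

  L<n : L < n
  L<n = proj₁ (proj₂ f-occ)

  a<b : a < b
  a<b = proj₁ (proj₂ (proj₂ (proj₁ f-occ)))

  b<c : b < c
  b<c = proj₂ (proj₂ (proj₂ (proj₁ f-occ)))

  only : ∀ {p q r} → r < n → Occ132 f p q r → p ≡ i × q ≡ suc i × r ≡ L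
  only = proj₂ (proj₂ f-occ)

  i<n : i < n
  i<n = <-trans (i<middle i k) L<n

  middle<n : ∀ {x} → x < k → middle i x < n
  middle<n x<k = <-trans (middle-mono i x<k) L<n

  2+i<m : suc (suc i) < m
  2+i<m = +-cancelʳ-< k (suc (suc i)) m L<n

  i<m : i < m
  i<m = <-trans (n<1+n i) (<-trans (n<1+n (suc i)) 2+i<m)

  middle<a : ∀ {x} → x < k → f (middle i x) < a
  middle<a = middle<first f-inj f-occ

  middle<before : ∀ {p x} → p < i → f p < a → x < k → f (middle i x) < f p
  middle<before {p} {x} p<i fp<a x<k with <-cmp (f (middle i x)) (f p)
  ... | tri< lt _ _ = lt
  ... | tri≈ _ e _ = contradiction (f-inj (<-trans p<i i<n) (middle<n x<k) (sym e)) (<⇒≢ (<-trans p<i (i<middle i x)))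
  ... | tri> _ _ gt =
    contradiction (proj₁ (only (middle<n x<k) (m<n⇒m<1+n p<i , 1+i<middle i x , gt , <-trans (middle<a x<k) (<-trans a<b b<c))))
      (<⇒≢ p<i)

  after<middle : ∀ {q x} → L < q → q < n → f q < a → x < k → f q < f (middle i x)
  after<middle {q} {x} L<q q<n fq<a x<k with <-cmp (f q) (f (middle i x))
  ... | tri< lt _ _ = lt
  ... | tri≈ _ e _ = contradiction (f-inj q<n (middle<n x<k) e) (>⇒≢ (<-trans (middle-mono i x<k) L<q))
  ... | tri> _ _ gt =
    contradiction (proj₁ (only q<n (middle-mono i x<k , L<q , gt , <-trans fq<a a<b))) (>⇒≢ (i<middle i x))

  t≤middle : ∀ {x} → x < k → t ≤ f (middle i x)
  t≤middle x<k with threshold-attained f i L n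
  ... | inj₁ t≡0 = subst (_≤ _) (sym t≡0) z≤n
  ... | inj₂ (q , L<q , q<n , fq<a , t≡1+fq) = subst (_≤ _) (sym t≡1+fq) (after<middle L<q q<n fq<a x<k)

  -- Letters before i that are smaller than a exceed every middle letter, and letters after L
  -- that are smaller than a stay below t; so the middle letters are the only ones in [t, f (middle i x)].
  ≤middle⇒middle : ∀ {v x} → x < k → t ≤ v → v ≤ f (middle i x) → ∃[ y ] y < k × f (middle i y) ≡ v
  ≤middle⇒middle {v} {x} x<k t≤v v≤fx
    with injectiveOn⇒surjectiveOn f-into f-inj (<-trans (≤-<-trans v≤fx (middle<a x<k)) (f-into i<n))
  ... | p , p<n , refl with position i k p
  ...   | before p<i = contradiction v≤fx (<⇒≱ (middle<before p<i (≤-<-trans v≤fx (middle<a x<k)) x<k))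
  ...   | atA refl = contradiction (≤-<-trans v≤fx (middle<a x<k)) (<-irrefl refl)
  ...   | atC refl = contradiction (≤-<-trans v≤fx (middle<a x<k)) (<-asym (<-trans a<b b<c))
  ...   | inside y y<k refl = y , y<k , refl
  ...   | atB refl = contradiction (≤-<-trans v≤fx (middle<a x<k)) (<-asym a<b)
  ...   | after L<p = contradiction t≤v (<⇒≱ (threshold-ub f i L<p p<n (≤-<-trans v≤fx (middle<a x<k))))

  -- otherwise the k + 1 values t, ..., t + k would all be among the k middle letters
  middle<t+k : ∀ {x} → x < k → f (middle i x) < t + k
  middle<t+k {x} x<k = ≰⇒> λ t+k≤fx → contradiction (Data.Fin.Properties.injective⇒≤ (G-injective t+k≤fx)) 1+n≰n
    where
    hit : t + k ≤ f (middle i x) → (w : Fin (suc k)) → ∃[ y ] y < k × f (middle i y) ≡ t + toℕ w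
    hit t+k≤fx w = ≤middle⇒middle x<k (m≤m+n t (toℕ w)) (≤-trans (+-monoʳ-≤ t (s≤s⁻¹ (toℕ<n w))) t+k≤fx)
    G : t + k ≤ f (middle i x) → Fin (suc k) → Fin k
    G t+k≤fx w = fromℕ< (proj₁ (proj₂ (hit t+k≤fx w)))
    G-injective : ∀ t+k≤fx {w w′} → G t+k≤fx w ≡ G t+k≤fx w′ → w ≡ w′
    G-injective t+k≤fx {w} {w′} e with hit t+k≤fx w | hit t+k≤fx w′
    ... | y , _ , fy≡ | y′ , _ , fy′≡ =
      toℕ-injective (+-cancelˡ-≡ t _ _ (trans (sym fy≡) (trans (cong (f ∘ middle i) y≡y′) fy′≡)))
      where
      y≡y′ : y ≡ y′
      y≡y′ = trans (sym (toℕ-fromℕ< _)) (trans (cong toℕ e) (toℕ-fromℕ< _))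

  offset : ℕ → ℕ
  offset x = f (middle i x) ∸ t

  offset<k : ∀ {x} → x < k → offset x < k
  offset<k x<k = subst (offset _ <_) (m+n∸m≡n t k) (∸-monoˡ-< (middle<t+k x<k) (t≤middle x<k))

  offset-injective : InjectiveOn k offset
  offset-injective x<k y<k e =
    middle-injective i (f-inj (middle<n x<k) (middle<n y<k) (∸-cancelʳ-≡ (t≤middle x<k) (t≤middle y<k) e))

  block⊆middle : ∀ {v} → InBlock t k v → ∃[ x ] x < k × f (middle i x) ≡ v
  block⊆middle {v} (t≤v , v<t+k) with
    injectiveOn⇒surjectiveOn offset<k offset-injective (subst (v ∸ t <_) (m+n∸m≡n t k) (∸-monoˡ-< v<t+k t≤v))
  ... | x , x<k , e = x , x<k , ∸-cancelʳ-≡ (t≤middle x<k) t≤v e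

  t+k≤a : t + k ≤ a
  t+k≤a = subst (t + k ≤_) (m+[n∸m]≡n (threshold-≤ f i L n))
    (+-monoʳ-≤ t (injectiveOn⇒≤ offset (λ x<k → ∸-monoˡ-< (middle<a x<k) (t≤middle x<k)) offset-injective))

  outside : ∀ {p} → p < n → (∀ {x} → x < k → p ≢ middle i x) → Outside t k (f p)
  outside {p} p<n not-middle with f p <? t | t + k ≤? f p
  ... | yes fp<t | _ = inj₁ fp<t
  ... | no _ | yes t+k≤fp = inj₂ t+k≤fp
  ... | no fp≮t | no t+k≰fp with block⊆middle (≮⇒≥ fp≮t , ≰⇒> t+k≰fp)
  ...   | x , x<k , e = contradiction (f-inj p<n (middle<n x<k) (sym e)) (not-middle x<k)

  outer-outside : ∀ {p} → p < m → Outside t k (f (skipWindow i k p))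
  outer-outside {p} p<m = outside (skipWindow-< p<m) (skipWindow-≢middle i k p)

  module Outer = Restriction {m} {n} f (skipWindow i k) (collapse t k) (Outside t k)
    skipWindow-mono skipWindow-< outer-outside collapse-mono f-inj

  outer-injective : InjectiveOn m (outerPart f i k t)
  outer-injective = Outer.injective

  outer-occ : UniqueOcc132 m (outerPart f i k t) i (suc i) (suc (suc i))
  outer-occ = Outer.unique-occ f-occ (if-< (<-trans (n<1+n i) (n<1+n (suc i)))) (if-< (n<1+n (suc i))) (if-≥ (≤-refl {suc (suc i)}))
    (n<1+n i) (n<1+n (suc i)) 2+i<m

  outer-into : MapsInto m (outerPart f i k t)
  outer-into {p} p<m with outer-outside p<m
  ... | inj₁ fp<t = subst (_< m) (sym (if-< fp<t)) (<-trans fp<t t<m)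
    where
    t<m : t < m
    t<m = +-cancelʳ-< k t m (≤-<-trans t+k≤a (f-into i<n))
  ... | inj₂ t+k≤fp = subst (_< m) (sym (if-≥ (m+n≤o⇒m≤o t t+k≤fp)))
    (subst (_ <_) (m+n∸n≡m m k) (∸-monoˡ-< (f-into (skipWindow-< p<m)) (m+n≤o⇒n≤o t t+k≤fp)))

  open WindowStd {t} {k} t+k≤a a<b b<c using (ws-mono; ws-≤2+k; ws-block)

  i+x<n : ∀ {x} → x < k + 3 → i + x < n
  i+x<n x<k+3 = ≤-<-trans (i+x≤middle x<k+3) L<n

  inWindow : ∀ {x} → x < k + 3 → InWindow t k a b c (f (i + x))
  inWindow {zero} _ = inj₂ (inj₁ (cong f (+-identityʳ i)))
  inWindow {suc zero} _ = inj₂ (inj₂ (inj₂ (cong f (trans (+-suc i 0) (cong suc (+-identityʳ i))))))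
  inWindow {suc (suc y)} y+2<k+3 with <-cmp y k
  ... | tri< y<k _ _ = inj₁ (subst (InBlock t k) (cong f (sym (i+2+y≡middle i y))) (t≤middle y<k , middle<t+k y<k))
  ... | tri≈ _ refl _ = inj₂ (inj₂ (inj₁ (cong f (i+2+y≡middle i y))))
  ... | tri> _ _ k<y = contradiction (subst (suc (suc y) <_) (k+3≡3+k k) y+2<k+3) (≤⇒≯ (s≤s (s≤s k<y)))

  module Window = Restriction {k + 3} {n} f (i +_) (windowStd t k a b c) (InWindow t k a b c)
    (+-monoʳ-< i) i+x<n inWindow ws-mono f-inj

  window-injective : InjectiveOn (k + 3) (windowPart f i k t)
  window-injective = Window.injective

  window-occ : UniqueOcc132 (k + 3) (windowPart f i k t) 0 1 (suc (suc k))
  window-occ = Window.unique-occ f-occ (+-identityʳ i) (trans (+-suc i 0) (cong suc (+-identityʳ i))) (i+2+y≡middle i k)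
    z<s (s≤s z<s) (subst (suc (suc k) <_) (sym (k+3≡3+k k)) ≤-refl)

  window-into : MapsInto (k + 3) (windowPart f i k t)
  window-into {x} x<k+3 = subst (windowPart f i k t x <_) (sym (k+3≡3+k k)) (s≤s (ws-≤2+k (inWindow x<k+3)))

  outer-threshold : ∀ {h} → (∀ {p} → p < m → h p ≡ outerPart f i k t p) → threshold h i (suc (suc i)) m ≡ t
  outer-threshold {h} h≗ = threshold-after-window {h} {f} agree
    where
    agree : ∀ {q} → suc (suc i) < q → q < m → succIfBelow (h q) (h i) ≡ succIfBelow (f (q + k)) a
    agree {q} 2+i<q q<m = begin
      succIfBelow (h q) (h i)
        ≡⟨ cong₂ succIfBelow (trans (h≗ q<m) (cong (collapse t k ∘ f) (if-≥ (<⇒≤ 2+i<q))))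
                              (trans (h≗ i<m) (cong (collapse t k ∘ f) (if-< (<-trans (n<1+n i) (n<1+n (suc i)))))) ⟩
      succIfBelow (collapse t k (f (q + k))) (collapse t k a)
        ≡⟨ cong (succIfBelow _) (if-≥ (m+n≤o⇒m≤o t t+k≤a)) ⟩
      succIfBelow (collapse t k (f (q + k))) (a ∸ k)
        ≡⟨ succIfBelow-collapse t+k≤a (subst (Outside t k ∘ f) (if-≥ (<⇒≤ 2+i<q)) (outer-outside q<m))
             (threshold-ub f i (+-monoˡ-< k 2+i<q) (+-monoˡ-< k q<m)) ⟩
      succIfBelow (f (q + k)) a ∎

  insertWindow∘split : ∀ {h s} → (∀ {p} → p < m → h p ≡ outerPart f i k t p) →
    (∀ {x} → x < k + 3 → s x ≡ windowPart f i k t x) →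
    ∀ {p} → p < m + k → insertWindow h s i k (threshold h i (suc (suc i)) m) p ≡ f p
  insertWindow∘split {h} {s} h≗ s≗ {p} p<n rewrite outer-threshold h≗ with source 2+i<m p<n
  ... | outer p′ p′<m refl = begin
    insertWindow h s i k t (skipWindow i k p′)         ≡⟨ insertWindow-skip h s i k t p′ ⟩
    expand t k (h p′)                                  ≡⟨ cong (expand t k) (h≗ p′<m) ⟩
    expand t k (collapse t k (f (skipWindow i k p′)))  ≡⟨ expand∘collapse (outer-outside p′<m) ⟩
    f (skipWindow i k p′)                              ∎
  ... | inner y y<k refl = begin
    insertWindow h s i k t (middle i y)                ≡⟨ insertWindow-middle h s i k t y<k ⟩
    s (suc (suc y)) + t                                ≡⟨ cong (_+ t) (s≗ (2+y<k+3 y<k)) ⟩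
    windowStd t k a b c (f (i + suc (suc y))) + t      ≡⟨ cong (λ q → windowStd t k a b c (f q) + t) (i+2+y≡middle i y) ⟩
    windowStd t k a b c (f (middle i y)) + t           ≡⟨ cong (_+ t) (ws-block (t≤middle y<k , middle<t+k y<k)) ⟩
    f (middle i y) ∸ t + t                             ≡⟨ m∸n+n≡m (t≤middle y<k) ⟩
    f (middle i y)                                     ∎

-- Merging ρ and σ into π

module Backward (m k : ℕ) (h s : ℕ → ℕ) (i : ℕ)
  (h-inj : InjectiveOn m h) (h-into : MapsInto m h) (h-occ : UniqueOcc132 m h i (suc i) (suc (suc i)))
  (s-inj : InjectiveOn (k + 3) s) (s-into : MapsInto (k + 3) s) (s-occ : UniqueOcc132 (k + 3) s 0 1 (suc (suc k)))
  where

  n L a b c t : ℕ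
  n = m + k
  L = middle i k
  a = h i
  b = h (suc (suc i))
  c = h (suc i)
  t = threshold h i (suc (suc i)) m

  a<b : a < b
  a<b = proj₁ (proj₂ (proj₂ (proj₁ h-occ)))

  b<c : b < c
  b<c = proj₂ (proj₂ (proj₂ (proj₁ h-occ)))

  2+i<m : suc (suc i) < m
  2+i<m = proj₁ (proj₂ h-occ)

  i<m : i < m
  i<m = <-trans (n<1+n i) (<-trans (n<1+n (suc i)) 2+i<m)

  only : ∀ {p q r} → r < m → Occ132 h p q r → p ≡ i × q ≡ suc i × r ≡ suc (suc i)
  only = proj₂ (proj₂ h-occ)

  s-inj′ : InjectiveOn (3 + k) s
  s-inj′ {p} {q} p< q< = s-inj (subst (p <_) (+-comm 3 k) p<) (subst (q <_) (+-comm 3 k) q<)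

  s-occ′ : UniqueOcc132 (3 + k) s 0 1 (middle 0 k)
  s-occ′ = let (o , L< , u) = s-occ in
    o , subst (suc (suc k) <_) (k+3≡3+k k) L< , λ {_} {_} {r} r< → u (subst (r <_) (+-comm 3 k) r<)

  s-middle<s0 : ∀ {y} → y < k → s (suc (suc y)) < s 0
  s-middle<s0 = middle<first s-inj′ s-occ′

  s0<sL : s 0 < s (suc (suc k))
  s0<sL = proj₁ (proj₂ (proj₂ (proj₁ s-occ)))

  sL<s1 : s (suc (suc k)) < s 1
  sL<s1 = proj₂ (proj₂ (proj₂ (proj₁ s-occ)))

  s1≤2+k : s 1 ≤ suc (suc k)
  s1≤2+k = s≤s⁻¹ (subst (s 1 <_) (k+3≡3+k k) (s-into (subst (1 <_) (sym (k+3≡3+k k)) (s≤s z<s))))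

  s0≡k : s 0 ≡ k
  s0≡k = ≤-antisym (s≤s⁻¹ (≤-trans s0<sL (s≤s⁻¹ (≤-trans sL<s1 s1≤2+k))))
    (injectiveOn⇒≤ (λ y → s (suc (suc y))) s-middle<s0
      (λ y<k y′<k e → suc-injective (suc-injective (s-inj (2+y<k+3 y<k) (2+y<k+3 y′<k) e))))

  sL≡1+k : s (suc (suc k)) ≡ suc k
  sL≡1+k = ≤-antisym (s≤s⁻¹ (<-≤-trans sL<s1 s1≤2+k)) (subst (_< s (suc (suc k))) s0≡k s0<sL)

  s1≡2+k : s 1 ≡ suc (suc k)
  s1≡2+k = ≤-antisym s1≤2+k (subst (_< s 1) sL≡1+k sL<s1)

  s-middle<k : ∀ {y} → y < k → s (suc (suc y)) < k
  s-middle<k y<k = subst (_ <_) s0≡k (s-middle<s0 y<k)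

  t≤a : t ≤ a
  t≤a = threshold-≤ h i (suc (suc i)) m

  before-large : ∀ {p} → p < suc (suc i) → t ≤ h p
  before-large {p} p<2+i with <-cmp p i
  ... | tri≈ _ refl _ = t≤a
  ... | tri> _ _ i<p rewrite ≤-antisym (s≤s⁻¹ p<2+i) i<p = ≤-trans t≤a (<⇒≤ (<-trans a<b b<c))
  ... | tri< p<i _ _ with threshold-attained h i (suc (suc i)) m
  ...   | inj₁ t≡0 = subst (_≤ h p) (sym t≡0) z≤n
  ...   | inj₂ (q , 2+i<q , q<m , hq<a , t≡1+hq) with <-cmp (h q) (h p)
  ...     | tri< hq<hp _ _ = subst (_≤ h p) (sym t≡1+hq) hq<hp
  ...     | tri≈ _ hq≡hp _ = contradiction (h-inj (<-trans p<i i<m) q<m (sym hq≡hp)) (<⇒≢ p<q)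
    where p<q = <-trans p<i (<-trans (n<1+n i) (<-trans (n<1+n (suc i)) 2+i<q))
  ...     | tri> _ _ hp<hq =
    contradiction (proj₁ (only q<m (s≤s (<⇒≤ p<i) , <-trans (n<1+n (suc i)) 2+i<q , hp<hq , <-trans hq<a (<-trans a<b b<c))))
      (<⇒≢ p<i)

  after-large : ∀ {q} → suc (suc i) < q → q < m → t ≤ h q → a < h q
  after-large {q} 2+i<q q<m t≤hq with <-cmp a (h q)
  ... | tri< a<hq _ _ = a<hq
  ... | tri≈ _ a≡hq _ = contradiction (h-inj i<m q<m a≡hq) (<⇒≢ (<-trans (n<1+n i) (<-trans (n<1+n (suc i)) 2+i<q)))
  ... | tri> _ _ hq<a = contradiction t≤hq (<⇒≱ (threshold-ub h i 2+i<q q<m hq<a))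

  π : ℕ → ℕ
  π = insertWindow h s i k t

  π-skip : ∀ p → π (skipWindow i k p) ≡ expand t k (h p)
  π-skip = insertWindow-skip h s i k t

  π-middle : ∀ {y} → y < k → π (middle i y) ≡ s (suc (suc y)) + t
  π-middle = insertWindow-middle h s i k t

  π-outer : ∀ p → Outside t k (π (skipWindow i k p))
  π-outer p = subst (Outside t k) (sym (π-skip p)) (expand-outside t k (h p))

  π-inner : ∀ {y} → y < k → InBlock t k (π (middle i y))
  π-inner {y} y<k = subst (InBlock t k) (sym (π-middle y<k))
    (m≤n+m t _ , subst (s (suc (suc y)) + t <_) (+-comm k t) (+-monoˡ-< t (s-middle<k y<k)))

  -- an outer letter to the left of the inserted block sits at or before c, so above the block in value
  outer-before-inner : ∀ {p′ y} → y < k → skipWindow i k p′ < middle i y →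
    π (skipWindow i k p′) < π (middle i y) → ⊥
  outer-before-inner {p′} y<k lt πp<πy with π-outer p′ | skipWindow<middle {p = p′} y<k lt
  ... | inj₂ t+k≤πp | _ = <⇒≱ (<-trans πp<πy (proj₂ (π-inner y<k))) t+k≤πp
  ... | inj₁ πp<t | p′<2+i , _ =
    <⇒≱ πp<t (subst (t ≤_) (sym (π-skip p′)) (≤-trans (before-large p′<2+i) (expand-≥ t k (h p′))))

  π-injective : InjectiveOn n π
  π-injective {p} {q} p<n q<n e with source 2+i<m p<n | source 2+i<m q<n
  ... | outer p′ p′<m refl | outer q′ q′<m refl =
    cong (skipWindow i k) (h-inj p′<m q′<m
      (strictMono⇒injective (expand-mono {t} {k}) (trans (sym (π-skip p′)) (trans e (π-skip q′)))))
  ... | outer p′ _ refl | inner y y<k refl = ⊥-elim (outside-block (π-outer p′) (subst (InBlock t k) (sym e) (π-inner y<k)))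
  ... | inner y y<k refl | outer q′ _ refl = ⊥-elim (outside-block (π-outer q′) (subst (InBlock t k) e (π-inner y<k)))
  ... | inner y y<k refl | inner y′ y′<k refl =
    cong (middle i) (suc-injective (suc-injective (s-inj (2+y<k+3 y<k) (2+y<k+3 y′<k)
      (+-cancelʳ-≡ t _ _ (trans (sym (π-middle y<k)) (trans e (π-middle y′<k)))))))

  π-into : MapsInto n π
  π-into {p} p<n with source 2+i<m p<n
  ... | outer p′ p′<m refl = subst (_< n) (sym (π-skip p′)) (≤-<-trans (expand-≤ t k (h p′)) (+-monoˡ-< k (h-into p′<m)))
  ... | inner y y<k refl = subst (_< n) (sym (π-middle y<k))
    (subst (s (suc (suc y)) + t <_) (+-comm k m) (+-mono-<-≤ (s-middle<k y<k) (<⇒≤ (≤-<-trans t≤a (h-into i<m)))))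

  skip-i : skipWindow i k i ≡ i
  skip-i = if-< (<-trans (n<1+n i) (n<1+n (suc i)))

  skip-1+i : skipWindow i k (suc i) ≡ suc i
  skip-1+i = if-< (n<1+n (suc i))

  skip-2+i : skipWindow i k (suc (suc i)) ≡ L
  skip-2+i = if-≥ (≤-refl {suc (suc i)})

  π-expand : ∀ {p q} → h p < h q → π (skipWindow i k p) < π (skipWindow i k q)
  π-expand {p} {q} hp<hq = subst₂ _<_ (sym (π-skip p)) (sym (π-skip q)) (expand-mono {t} {k} hp<hq)

  π-reflect : ∀ {p q} → π (skipWindow i k p) < π (skipWindow i k q) → h p < h q
  π-reflect {p} {q} lt = strictMono⇒reflects-< (expand-mono {t} {k}) (subst₂ _<_ (π-skip p) (π-skip q) lt)

  -- otherwise i , q′ , r′ would be a second occurrence in h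
  inner-outer-outer : ∀ {y q′ r′} → y < k → r′ < m → middle i y < skipWindow i k q′ →
    skipWindow i k q′ < skipWindow i k r′ → t < π (skipWindow i k r′) →
    π (skipWindow i k r′) < π (skipWindow i k q′) → ⊥
  inner-outer-outer {y} {q′} {r′} y<k r′<m p<q q<r t<πr πr<πq with π-outer r′
  ... | inj₁ πr<t = <-asym t<πr πr<t
  ... | inj₂ t+k≤πr = <⇒≢ 2+i<r′ (sym (proj₂ (proj₂ (only r′<m second-occ))))
    where
    2+i≤q′ = middle<skipWindow {p = q′} p<q
    q′<r′ = strictMono⇒reflects-< (skipWindow-mono {i} {k}) q<r
    2+i<r′ = <-≤-trans (s≤s 2+i≤q′) q′<r′
    second-occ : Occ132 h i q′ r′
    second-occ = <-≤-trans (<-trans (n<1+n i) (n<1+n (suc i))) 2+i≤q′ , q′<r′ ,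
      after-large 2+i<r′ r′<m (expand-reflects-≥ (subst (t ≤_) (π-skip r′) (m+n≤o⇒m≤o t t+k≤πr))) ,
      π-reflect πr<πq

  occ-sources : ∀ {p q r} → Source m i k p → Source m i k q → Source m i k r → Occ132 π p q r →
    p ≡ i × q ≡ suc i × r ≡ L
  occ-sources (outer p′ _ refl) (outer q′ _ refl) (outer r′ r′<m refl) (p<q , q<r , πp<πr , πr<πq)
    with only {p′} {q′} r′<m (strictMono⇒reflects-< (skipWindow-mono {i} {k}) p<q ,
                              strictMono⇒reflects-< (skipWindow-mono {i} {k}) q<r , π-reflect πp<πr , π-reflect πr<πq)
  ... | refl , refl , refl = skip-i , skip-1+i , skip-2+i
  occ-sources (inner y₁ y₁<k refl) (inner y₂ y₂<k refl) (inner y₃ y₃<k refl) (p<q , q<r , πp<πr , πr<πq)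
    with proj₂ (proj₂ s-occ) (2+y<k+3 y₃<k)
      (s≤s (s≤s (strictMono⇒reflects-< (middle-mono i) p<q)) , s≤s (s≤s (strictMono⇒reflects-< (middle-mono i) q<r)) ,
       +-cancelʳ-< t _ _ (subst₂ _<_ (π-middle y₁<k) (π-middle y₃<k) πp<πr) ,
       +-cancelʳ-< t _ _ (subst₂ _<_ (π-middle y₃<k) (π-middle y₂<k) πr<πq))
  ... | () , _
  occ-sources (outer p′ _ refl) (inner _ y<k refl) _ (p<q , _ , πp<πr , πr<πq) =
    ⊥-elim (outer-before-inner {p′} y<k p<q (<-trans πp<πr πr<πq))
  occ-sources (outer p′ _ refl) (outer _ _ refl) (inner _ y<k refl) (p<q , q<r , πp<πr , _) =
    ⊥-elim (outer-before-inner {p′} y<k (<-trans p<q q<r) πp<πr)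
  occ-sources (inner y₁ _ refl) (outer q′ _ refl) (inner _ y<k refl) (p<q , q<r , _) with skipWindow<middle {p = q′} y<k q<r
  ... | q′<2+i , e = ⊥-elim (<⇒≱ (<-trans p<q (subst (_< suc (suc i)) (sym e) q′<2+i)) (1+i<middle i y₁))
  occ-sources (inner _ y₁<k refl) (inner _ y₂<k refl) (outer r′ _ refl) (_ , _ , πp<πr , πr<πq) =
    ⊥-elim (outside-block (π-outer r′)
      (≤-trans (proj₁ (π-inner y₁<k)) (<⇒≤ πp<πr) , <-trans πr<πq (proj₂ (π-inner y₂<k))))
  occ-sources (inner _ y<k refl) (outer q′ _ refl) (outer r′ r′<m refl) (p<q , q<r , πp<πr , πr<πq) =
    ⊥-elim (inner-outer-outer {q′ = q′} y<k r′<m p<q q<r (≤-<-trans (proj₁ (π-inner y<k)) πp<πr) πr<πq)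

  π-occ : UniqueOcc132 n π i (suc i) L
  π-occ = (n<1+n i , 1+i<middle i k ,
           subst₂ _<_ (cong π skip-i) (cong π skip-2+i) (π-expand a<b) ,
           subst₂ _<_ (cong π skip-2+i) (cong π skip-1+i) (π-expand b<c)) ,
          L<n , λ r<n o@(p<q , q<r , _) →
            occ-sources (source 2+i<m (<-trans p<q (<-trans q<r r<n))) (source 2+i<m (<-trans q<r r<n)) (source 2+i<m r<n) o
    where
    L<n : L < n
    L<n = +-monoˡ-< k 2+i<m

  t≤c : t ≤ c
  t≤c = ≤-trans t≤a (<⇒≤ (<-trans a<b b<c))

  π-i : π i ≡ a + k
  π-i = trans (cong π (sym skip-i)) (trans (π-skip i) (if-≥ t≤a))

  π-1+i : π (suc i) ≡ c + k
  π-1+i = trans (cong π (sym skip-1+i)) (trans (π-skip (suc i)) (if-≥ t≤c))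

  π-L : π L ≡ b + k
  π-L = trans (cong π (sym skip-2+i)) (trans (π-skip (suc (suc i))) (if-≥ (≤-trans t≤a (<⇒≤ a<b))))

  i<n : i < n
  i<n = <-≤-trans i<m (m≤m+n m k)

  L<n : L < n
  L<n = +-monoˡ-< k 2+i<m

  inserted-threshold : ∀ {g} → (∀ {p} → p < n → g p ≡ π p) → threshold g i L n ≡ t
  inserted-threshold {g} g≗ = sym (threshold-after-window {h} {g} agree)
    where
    agree : ∀ {q} → suc (suc i) < q → q < m → succIfBelow (h q) a ≡ succIfBelow (g (q + k)) (g i)
    agree {q} 2+i<q q<m = sym (begin
      succIfBelow (g (q + k)) (g i)
        ≡⟨ cong₂ succIfBelow (trans (g≗ (+-monoˡ-< k q<m)) (trans (cong π (sym (if-≥ (<⇒≤ 2+i<q)))) (π-skip q)))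
                              (trans (g≗ i<n) π-i) ⟩
      succIfBelow (expand t k (h q)) (a + k) ≡⟨ succIfBelow-expand t≤a (threshold-ub h i 2+i<q q<m) ⟩
      succIfBelow (h q) a                    ∎)

  outerPart∘insertWindow : ∀ {g} → (∀ {p} → p < n → g p ≡ π p) →
    ∀ {p} → p < m → outerPart g i k (threshold g i L n) p ≡ h p
  outerPart∘insertWindow {g} g≗ {p} p<m rewrite inserted-threshold g≗ = begin
    collapse t k (g (skipWindow i k p))  ≡⟨ cong (collapse t k) (g≗ (skipWindow-< p<m)) ⟩
    collapse t k (π (skipWindow i k p))  ≡⟨ cong (collapse t k) (π-skip p) ⟩
    collapse t k (expand t k (h p))      ≡⟨ collapse∘expand t k (h p) ⟩
    h p                                  ∎

  open WindowStd {t} {k} {a + k} {b + k} {c + k} (+-monoˡ-≤ k t≤a) (+-monoˡ-< k a<b) (+-monoˡ-< k b<c)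
    using (ws; ws-a; ws-b; ws-c; ws-block)

  ws∘π : ∀ {x} → x < k + 3 → ws (π (i + x)) ≡ s x
  ws∘π {zero} _ = trans (cong (ws ∘ π) (+-identityʳ i)) (trans (cong ws π-i) (trans ws-a (sym s0≡k)))
  ws∘π {suc zero} _ =
    trans (cong (ws ∘ π) (trans (+-suc i 0) (cong suc (+-identityʳ i)))) (trans (cong ws π-1+i) (trans ws-c (sym s1≡2+k)))
  ws∘π {suc (suc y)} y+2<k+3 with <-cmp y k
  ... | tri< y<k _ _ = begin
    ws (π (i + suc (suc y)))    ≡⟨ cong (ws ∘ π) (i+2+y≡middle i y) ⟩
    ws (π (middle i y))         ≡⟨ ws-block (π-inner y<k) ⟩
    π (middle i y) ∸ t          ≡⟨ cong (_∸ t) (π-middle y<k) ⟩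
    s (suc (suc y)) + t ∸ t     ≡⟨ m+n∸n≡m _ t ⟩
    s (suc (suc y))             ∎
  ... | tri≈ _ refl _ = trans (cong (ws ∘ π) (i+2+y≡middle i k)) (trans (cong ws π-L) (trans ws-b (sym sL≡1+k)))
  ... | tri> _ _ k<y = contradiction (subst (suc (suc y) <_) (k+3≡3+k k) y+2<k+3) (≤⇒≯ (s≤s (s≤s k<y)))

  windowPart∘insertWindow : ∀ {g} → (∀ {p} → p < n → g p ≡ π p) →
    ∀ {x} → x < k + 3 → windowPart g i k (threshold g i L n) x ≡ s x
  windowPart∘insertWindow {g} g≗ {x} x<k+3
    rewrite inserted-threshold g≗ | g≗ i<n | g≗ L<n | g≗ (<-trans (1+i<middle i k) L<n)
          | g≗ (≤-<-trans (i+x≤middle x<k+3) L<n)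
          | π-i | π-L | π-1+i = ws∘π x<k+3

-- Words as vectors

≗-injectiveOn : ∀ {N f g} → (∀ {p} → p < N → f p ≡ g p) → InjectiveOn N f → InjectiveOn N g
≗-injectiveOn f≗g f-inj p<N q<N e = f-inj p<N q<N (trans (f≗g p<N) (trans e (sym (f≗g q<N))))

≗-occ132 : ∀ {N f g} → (∀ {p} → p < N → f p ≡ g p) → ∀ {p q r} → r < N → Occ132 f p q r → Occ132 g p q r
≗-occ132 f≗g r<N (p<q , q<r , fp<fr , fr<fq) =
  p<q , q<r , subst₂ _<_ (f≗g p<N) (f≗g r<N) fp<fr , subst₂ _<_ (f≗g r<N) (f≗g q<N) fr<fq
  where
  q<N = <-trans q<r r<N
  p<N = <-trans p<q q<N

≗-uniqueOcc132 : ∀ {N f g i j l} → (∀ {p} → p < N → f p ≡ g p) → UniqueOcc132 N f i j l → UniqueOcc132 N g i j l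
≗-uniqueOcc132 f≗g (o , l<N , only) =
  ≗-occ132 f≗g l<N o , l<N , λ r<N o′ → only r<N (≗-occ132 (λ p<N → sym (f≗g p<N)) r<N o′)

filter≡[_] : ∀ {A : Set} {P : A → Set} (P? : Decidable P) {xs : List A} {t : A} →
  Unique xs → t ∈ xs → P t → (∀ {u} → u ∈ xs → P u → u ≡ t) → filter P? xs ≡ t ∷ []
filter≡[_] {P = P} P? {x ∷ xs} {t} (x∉xs ∷ xs-unique) t∈ Pt only with P? x
... | yes Px =
  cong₂ _∷_ x≡t (filter-none P? (All.tabulate λ u∈ Pu → All.lookup x∉xs u∈ (trans x≡t (sym (only (there u∈) Pu)))))
  where
  x≡t : x ≡ t
  x≡t = only (here refl) Px
... | no ¬Px = filter≡[_] P? xs-unique (t∈xs t∈) Pt (λ u∈ → only (there u∈))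
  where
  t∈xs : t ∈ x ∷ xs → t ∈ xs
  t∈xs (here refl) = contradiction Pt ¬Px
  t∈xs (there t∈) = t∈

concatMap-unique : ∀ {A B : Set} (f : A → List B) {xs : List A} → Unique xs → (∀ x → Unique (f x)) →
  (∀ {x x′ y} → y ∈ f x → y ∈ f x′ → x ≡ x′) → Unique (concatMap f xs)
concatMap-unique f {[]} _ _ _ = []
concatMap-unique f {x ∷ xs} (x∉xs ∷ xs-unique) f-unique f-disjoint =
  Uniqueₚ.++⁺ (f-unique x) (concatMap-unique f xs-unique f-unique f-disjoint) disjoint
  where
  disjoint : ∀ {y} → ¬ (y ∈ f x × y ∈ concatMap f xs)
  disjoint (y∈fx , y∈rest) with find (∈-concatMap⁻ f y∈rest)
  ... | x′ , x′∈xs , y∈fx′ = All.lookup x∉xs x′∈xs (f-disjoint y∈fx y∈fx′)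

triples-complete : ∀ n (t : Fin n × Fin n × Fin n) → t ∈ triples n
triples-complete n (i , j , l) =
  ∈-concatMap⁺ _ (lose (∈-allFin i) (∈-concatMap⁺ _ (lose (∈-allFin j) (∈-map⁺ (λ l → (i , j , l)) (∈-allFin l)))))

triples-unique : ∀ n → Unique (triples n)
triples-unique n = concatMap-unique _ (Uniqueₚ.allFin⁺ n) row-unique row-disjoint
  where
  row : Fin n → Fin n → List (Fin n × Fin n × Fin n)
  row i j = map (λ l → (i , j , l)) (allFin n)
  row-unique : ∀ i → Unique (concatMap (row i) (allFin n))
  row-unique i =
    concatMap-unique (row i) (Uniqueₚ.allFin⁺ n) (λ j → Uniqueₚ.map⁺ (cong (proj₂ ∘ proj₂)) (Uniqueₚ.allFin⁺ n)) disjoint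
    where
    disjoint : ∀ {j j′ y} → y ∈ row i j → y ∈ row i j′ → j ≡ j′
    disjoint {j} {j′} y∈ y∈′ with ∈-map⁻ (λ l → (i , j , l)) y∈ | ∈-map⁻ (λ l → (i , j′ , l)) y∈′
    ... | _ , _ , refl | _ , _ , e = cong (proj₁ ∘ proj₂) e
  row-disjoint : ∀ {i i′ y} → y ∈ concatMap (row i) (allFin n) → y ∈ concatMap (row i′) (allFin n) → i ≡ i′
  row-disjoint {i} {i′} y∈ y∈′
    with find (∈-concatMap⁻ (row i) {xs = allFin n} y∈) | find (∈-concatMap⁻ (row i′) {xs = allFin n} y∈′)
  ... | j , _ , y∈j | j′ , _ , y∈j′
    with ∈-map⁻ (λ l → (i , j , l)) y∈j | ∈-map⁻ (λ l → (i′ , j′ , l)) y∈j′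
  ... | _ , _ , refl | _ , _ , e = cong proj₁ e

-- 0 past the end of the word
at : ∀ {M L} → Vec (Fin M) L → ℕ → ℕ
at [] _ = 0
at (x ∷ xs) zero = toℕ x
at (x ∷ xs) (suc p) = at xs p

at-lookup : ∀ {M L} (v : Vec (Fin M) L) (i : Fin L) → at v (toℕ i) ≡ toℕ (lookup v i)
at-lookup (x ∷ xs) F.zero = refl
at-lookup (x ∷ xs) (F.suc i) = at-lookup xs i

at-fromℕ< : ∀ {M L} (v : Vec (Fin M) L) {p} (p<L : p < L) → at v p ≡ toℕ (lookup v (fromℕ< p<L))
at-fromℕ< v {p} p<L = trans (cong (at v) (sym (toℕ-fromℕ< p<L))) (at-lookup v (fromℕ< p<L))

at-into : ∀ {N} (v : Vec (Fin N) N) → MapsInto N (at v)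
at-into v p<N = subst (_< _) (sym (at-fromℕ< v p<N)) (toℕ<n _)

at-injective : ∀ {M L} {v w : Vec (Fin M) L} → (∀ {p} → p < L → at v p ≡ at w p) → v ≡ w
at-injective {v = []} {[]} _ = refl
at-injective {v = x ∷ xs} {y ∷ ys} eq = cong₂ _∷_ (toℕ-injective (eq z<s)) (at-injective (λ p<L → eq (s<s p<L)))

wordOf : ∀ N (f : ℕ → ℕ) → MapsInto N f → Vec (Fin N) N
wordOf N f f-into = tabulate (λ p → fromℕ< (f-into (toℕ<n p)))

at-wordOf : ∀ {N f} (f-into : MapsInto N f) {p} → p < N → at (wordOf N f f-into) p ≡ f p
at-wordOf {N} {f} f-into {p} p<N = begin
  at (wordOf N f f-into) p                                  ≡⟨ at-fromℕ< (wordOf N f f-into) p<N ⟩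
  toℕ (lookup (wordOf N f f-into) (fromℕ< p<N))             ≡⟨ cong toℕ (lookup∘tabulate _ (fromℕ< p<N)) ⟩
  toℕ (fromℕ< (f-into (toℕ<n (fromℕ< p<N))))                ≡⟨ toℕ-fromℕ< _ ⟩
  f (toℕ (fromℕ< p<N))                                      ≡⟨ cong f (toℕ-fromℕ< p<N) ⟩
  f p                                                       ∎

allB⁻ : ∀ {A : Set} (p : A → Bool) {xs} → T (allB p xs) → ∀ {x} → x ∈ xs → T (p x)
allB⁻ p {y ∷ ys} all-p (here refl) = proj₁ (Equivalence.to T-∧ all-p)
allB⁻ p {y ∷ ys} all-p (there x∈) = allB⁻ p (proj₂ (Equivalence.to T-∧ all-p)) x∈

allB⁺ : ∀ {A : Set} (p : A → Bool) {xs} → (∀ {x} → x ∈ xs → T (p x)) → T (allB p xs)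
allB⁺ p {[]} _ = _
allB⁺ p {y ∷ ys} all-p = Equivalence.from T-∧ (all-p (here refl) , allB⁺ p (all-p ∘ there))

∨-not⁻ : ∀ {A B : Set} (a? : Dec A) (b? : Dec B) → T (⌊ a? ⌋ ∨ not ⌊ b? ⌋) → B → A
∨-not⁻ (yes a) _ _ _ = a
∨-not⁻ (no _) (no ¬b) _ b = contradiction b ¬b

∨-not⁺ : ∀ {A B : Set} (a? : Dec A) (b? : Dec B) → (B → A) → T (⌊ a? ⌋ ∨ not ⌊ b? ⌋)
∨-not⁺ (yes _) _ _ = _
∨-not⁺ (no ¬a) (yes b) b→a = contradiction (b→a b) ¬a
∨-not⁺ (no _) (no _) _ = _

distinct : ∀ {N} → Vec (Fin N) N → Fin N → Fin N → Bool
distinct π i j = ⌊ i F.≟ j ⌋ ∨ not ⌊ lookup π i F.≟ lookup π j ⌋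

isPerm⁻ : ∀ {N} (π : Vec (Fin N) N) → T (isPerm π) → InjectiveOn N (at π)
isPerm⁻ {N} π π-perm {p} {q} p<N q<N e =
  trans (sym (toℕ-fromℕ< p<N)) (trans (cong toℕ i≡j) (toℕ-fromℕ< q<N))
  where
  i = fromℕ< p<N
  j = fromℕ< q<N
  i≡j : i ≡ j
  i≡j = ∨-not⁻ (i F.≟ j) (lookup π i F.≟ lookup π j)
    (allB⁻ (distinct π i) {allFin N}
      (allB⁻ (λ i → allB (distinct π i) (allFin N)) {allFin N} π-perm (∈-allFin i)) (∈-allFin j))
    (toℕ-injective (trans (sym (at-fromℕ< π p<N)) (trans e (at-fromℕ< π q<N))))

isPerm⁺ : ∀ {N} (π : Vec (Fin N) N) → InjectiveOn N (at π) → T (isPerm π)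
isPerm⁺ {N} π inj =
  allB⁺ (λ i → allB (distinct π i) (allFin N)) {allFin N} λ {i} _ → allB⁺ (distinct π i) {allFin N} λ {j} _ →
  ∨-not⁺ (i F.≟ j) (lookup π i F.≟ lookup π j)
    (λ e → toℕ-injective (inj (toℕ<n i) (toℕ<n j) (trans (at-lookup π i) (trans (cong toℕ e) (sym (at-lookup π j))))))

T-⌊⌋∧⁻ : ∀ {A : Set} (a? : Dec A) {b} → T (⌊ a? ⌋ ∧ b) → A × T b
T-⌊⌋∧⁻ (yes a) b = a , b

T-⌊⌋∧⁺ : ∀ {A : Set} (a? : Dec A) {b} → A → T b → T (⌊ a? ⌋ ∧ b)
T-⌊⌋∧⁺ (yes _) _ b = b
T-⌊⌋∧⁺ (no ¬a) a _ = contradiction a ¬a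

is132⁻ : ∀ {N} (π : Vec (Fin N) N) i j l → T (is132 π (i , j , l)) → Occ132 (at π) (toℕ i) (toℕ j) (toℕ l)
is132⁻ π i j l occ =
  let (i<j , rest) = T-⌊⌋∧⁻ (toℕ i <? toℕ j) occ
      (j<l , values) = T-⌊⌋∧⁻ (toℕ j <? toℕ l) rest
      (πi<πl , πl<πj) = T-⌊⌋∧⁻ (toℕ (lookup π i) <? toℕ (lookup π l)) values
  in i<j , j<l ,
     subst₂ _<_ (sym (at-lookup π i)) (sym (at-lookup π l)) πi<πl ,
     subst₂ _<_ (sym (at-lookup π l)) (sym (at-lookup π j)) (toWitness πl<πj)

is132⁺ : ∀ {N} (π : Vec (Fin N) N) i j l → Occ132 (at π) (toℕ i) (toℕ j) (toℕ l) → T (is132 π (i , j , l))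
is132⁺ π i j l (i<j , j<l , πi<πl , πl<πj) =
  T-⌊⌋∧⁺ (toℕ i <? toℕ j) i<j (T-⌊⌋∧⁺ (toℕ j <? toℕ l) j<l
    (T-⌊⌋∧⁺ (toℕ (lookup π i) <? toℕ (lookup π l)) (subst₂ _<_ (at-lookup π i) (at-lookup π l) πi<πl)
      (fromWitness (subst₂ _<_ (at-lookup π l) (at-lookup π j) πl<πj))))

occ132⁻ : ∀ {N} (π : Vec (Fin N) N) {i j l} → occ132 π ≡ (i , j , l) ∷ [] →
  UniqueOcc132 N (at π) (toℕ i) (toℕ j) (toℕ l)
occ132⁻ {N} π {i} {j} {l} e = is132⁻ π i j l (proj₂ (∈-filter⁻ (T? ∘ is132 π) {xs = triples N} ijl∈)) , toℕ<n l , only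
  where
  ijl∈ : (i , j , l) ∈ occ132 π
  ijl∈ = subst ((i , j , l) ∈_) (sym e) (here refl)
  only : ∀ {p q r} → r < N → Occ132 (at π) p q r → p ≡ toℕ i × q ≡ toℕ j × r ≡ toℕ l
  only {p} {q} {r} r<N o@(p<q , q<r , _) with subst ((fromℕ< p<N , fromℕ< q<N , fromℕ< r<N) ∈_) e
      (∈-filter⁺ (T? ∘ is132 π) (triples-complete N _)
        (is132⁺ π _ _ _ (subst₂ (λ p′ q′ → Occ132 (at π) p′ q′ (toℕ (fromℕ< r<N))) (sym (toℕ-fromℕ< p<N)) (sym (toℕ-fromℕ< q<N))
          (subst (Occ132 (at π) p q) (sym (toℕ-fromℕ< r<N)) o))))
    where
    q<N = <-trans q<r r<N
    p<N = <-trans p<q q<N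
  ... | here refl = sym (toℕ-fromℕ< _) , sym (toℕ-fromℕ< _) , sym (toℕ-fromℕ< _)

occ132⁺ : ∀ {N} (π : Vec (Fin N) N) {i j l} → UniqueOcc132 N (at π) i j l →
  ∃[ x ] ∃[ y ] ∃[ z ] occ132 π ≡ (x , y , z) ∷ [] × toℕ x ≡ i × toℕ y ≡ j × toℕ z ≡ l
occ132⁺ {N} π {i} {j} {l} (o@(i<j , j<l , _) , l<N , only) =
  fromℕ< i<N , fromℕ< j<N , fromℕ< l<N ,
  filter≡[_] (T? ∘ is132 π) (triples-unique N) (triples-complete N _) (is132⁺ π _ _ _ o′) only′ ,
  toℕ-fromℕ< i<N , toℕ-fromℕ< j<N , toℕ-fromℕ< l<N
  where
  j<N = <-trans j<l l<N
  i<N = <-trans i<j j<N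
  o′ : Occ132 (at π) (toℕ (fromℕ< i<N)) (toℕ (fromℕ< j<N)) (toℕ (fromℕ< l<N))
  o′ = subst₂ (λ i′ j′ → Occ132 (at π) i′ j′ (toℕ (fromℕ< l<N))) (sym (toℕ-fromℕ< i<N)) (sym (toℕ-fromℕ< j<N))
         (subst (Occ132 (at π) i j) (sym (toℕ-fromℕ< l<N)) o)
  only′ : ∀ {u} → u ∈ triples N → T (is132 π u) → u ≡ (fromℕ< i<N , fromℕ< j<N , fromℕ< l<N)
  only′ {p , q , r} _ u-occ with only (toℕ<n r) (is132⁻ π p q r u-occ)
  ... | p≡ , q≡ , r≡ = cong₂ _,_ (toℕ-injective (trans p≡ (sym (toℕ-fromℕ< i<N))))
    (cong₂ _,_ (toℕ-injective (trans q≡ (sym (toℕ-fromℕ< j<N)))) (toℕ-injective (trans r≡ (sym (toℕ-fromℕ< l<N)))))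

occStart : ∀ {N} → List (Fin N × Fin N × Fin N) → ℕ
occStart [] = 0
occStart ((i , _ , _) ∷ _) = toℕ i

j≡1+i⇒l≡middle : ∀ {i j l k} → j ≡ suc i → j < l → l ∸ j ∸ 1 ≡ k → l ≡ middle i k
j≡1+i⇒l≡middle {i} {_} {l} refl j<l l∸j∸1≡k =
  trans (sym (m+[n∸m]≡n j<l)) (cong (suc (suc i) +_) (trans (cong (l ∸_) (+-comm 1 (suc i)))
    (trans (sym (∸-+-assoc l (suc i) 1)) l∸j∸1≡k)))

middle∸1+i∸1≡k : ∀ i k → middle i k ∸ suc i ∸ 1 ≡ k
middle∸1+i∸1≡k i k = cong (_∸ 1) (trans (cong (_∸ i) (sym (+-suc i k))) (m+n∸m≡n i (suc k)))

inA⁻ : ∀ {N} k (π : Vec (Fin N) N) → T (inA k π) → let i = occStart (occ132 π) in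
  InjectiveOn N (at π) × UniqueOcc132 N (at π) i (suc i) (middle i k)
inA⁻ {N} k π π∈A with occ132 π in e
inA⁻ {N} k π () | []
inA⁻ {N} k π () | _ ∷ _ ∷ _
... | (i , j , l) ∷ [] with Equivalence.to (T-∧ {isPerm π}) π∈A
...   | π-perm , l∸j∸1≡k = π-inj , subst₂ (UniqueOcc132 N (at π) (toℕ i)) j≡1+i l≡middle occ
  where
  π-inj = isPerm⁻ π π-perm
  occ = occ132⁻ π e
  j≡1+i = uniqueOcc132-adjacent π-inj occ
  l≡middle = j≡1+i⇒l≡middle j≡1+i (proj₁ (proj₂ (proj₁ occ))) (toWitness l∸j∸1≡k)

inA⁺ : ∀ {N} k (π : Vec (Fin N) N) {i} → InjectiveOn N (at π) → UniqueOcc132 N (at π) i (suc i) (middle i k) →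
  T (inA k π) × occStart (occ132 π) ≡ i
inA⁺ k π π-inj occ with occ132⁺ π occ
... | x , y , z , e , refl , y≡ , z≡ rewrite e =
  Equivalence.from T-∧ (isPerm⁺ π π-inj ,
    fromWitness (subst₂ (λ y′ z′ → z′ ∸ y′ ∸ 1 ≡ k) (sym y≡) (sym z≡) (middle∸1+i∸1≡k (toℕ x) k))) ,
  refl

inB⁻ : ∀ {m} (ρ : Vec (Fin m) m) → T (inB ρ) → let i = occStart (occ132 ρ) in
  InjectiveOn m (at ρ) × UniqueOcc132 m (at ρ) i (suc i) (suc (suc i))
inB⁻ {m} ρ ρ∈B with occ132 ρ in e
inB⁻ {m} ρ () | []
inB⁻ {m} ρ () | _ ∷ _ ∷ _
... | (i , j , l) ∷ [] with Equivalence.to (T-∧ {isPerm ρ}) ρ∈B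
...   | ρ-perm , positions with T-⌊⌋∧⁻ (toℕ j ≟ suc (toℕ i)) positions
...     | j≡1+i , l≡1+j = isPerm⁻ ρ ρ-perm ,
  subst₂ (UniqueOcc132 m (at ρ) (toℕ i)) j≡1+i (trans (toWitness l≡1+j) (cong suc j≡1+i)) (occ132⁻ ρ e)

inB⁺ : ∀ {m} (ρ : Vec (Fin m) m) {i} → InjectiveOn m (at ρ) → UniqueOcc132 m (at ρ) i (suc i) (suc (suc i)) →
  T (inB ρ) × occStart (occ132 ρ) ≡ i
inB⁺ ρ ρ-inj occ with occ132⁺ ρ occ
... | x , y , z , e , refl , y≡ , z≡ rewrite e =
  Equivalence.from T-∧ (isPerm⁺ ρ ρ-inj ,
    T-⌊⌋∧⁺ (toℕ y ≟ suc (toℕ x)) y≡ (fromWitness (trans z≡ (cong suc (sym y≡))))) ,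
  refl

inD⁻ : ∀ {d} (σ : Vec (Fin (d + 3)) (d + 3)) → T (inD σ) →
  InjectiveOn (d + 3) (at σ) × UniqueOcc132 (d + 3) (at σ) 0 1 (suc (suc d))
inD⁻ {d} σ σ∈D with occ132 σ in e
inD⁻ {d} σ () | []
inD⁻ {d} σ () | _ ∷ _ ∷ _
... | (i , j , l) ∷ [] with Equivalence.to (T-∧ {isPerm σ}) σ∈D
...   | σ-perm , positions with T-⌊⌋∧⁻ (toℕ i ≟ 0) positions
...     | i≡0 , positions′ with T-⌊⌋∧⁻ (toℕ j ≟ 1) positions′
...       | j≡1 , 1+l≡d+3 = isPerm⁻ σ σ-perm ,
  subst₂ (λ i′ j′ → UniqueOcc132 (d + 3) (at σ) i′ j′ (suc (suc d))) i≡0 j≡1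
    (subst (UniqueOcc132 (d + 3) (at σ) (toℕ i) (toℕ j)) (suc-injective (trans (toWitness 1+l≡d+3) (k+3≡3+k d)))
      (occ132⁻ σ e))

inD⁺ : ∀ {d} (σ : Vec (Fin (d + 3)) (d + 3)) → InjectiveOn (d + 3) (at σ) → UniqueOcc132 (d + 3) (at σ) 0 1 (suc (suc d)) →
  T (inD σ)
inD⁺ {d} σ σ-inj occ with occ132⁺ σ occ
... | x , y , z , e , x≡ , y≡ , z≡ rewrite e =
  Equivalence.from T-∧ (isPerm⁺ σ σ-inj , T-⌊⌋∧⁺ (toℕ x ≟ 0) x≡ (T-⌊⌋∧⁺ (toℕ y ≟ 1) y≡
    (fromWitness (trans (cong suc z≡) (sym (k+3≡3+k d))))))

≡-subset : ∀ {A : Set} {P : A → Bool} {x y : A} {px : T (P x)} {py : T (P y)} →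
  x ≡ y → _≡_ {A = Σ A (T ∘ P)} (x , px) (y , py)
≡-subset refl = cong (_ ,_) (T-irrelevant _ _)

module Split {m k : ℕ} (π : Vec (Fin (m + k)) (m + k)) (π∈A : T (inA k π)) where

  f : ℕ → ℕ
  f = at π

  i : ℕ
  i = occStart (occ132 π)

  open Forward m k f i (proj₁ (inA⁻ k π π∈A)) (at-into π) (proj₂ (inA⁻ k π π∈A)) public

  ρ : Vec (Fin m) m
  ρ = wordOf m (outerPart f i k t) outer-into

  σ : Vec (Fin (k + 3)) (k + 3)
  σ = wordOf (k + 3) (windowPart f i k t) window-into

  ρ≗ : ∀ {p} → p < m → at ρ p ≡ outerPart f i k t p
  ρ≗ = at-wordOf outer-into

  σ≗ : ∀ {x} → x < k + 3 → at σ x ≡ windowPart f i k t x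
  σ≗ = at-wordOf window-into

  ρ∈B : T (inB ρ) × occStart (occ132 ρ) ≡ i
  ρ∈B = inB⁺ ρ (≗-injectiveOn (sym ∘ ρ≗) outer-injective) (≗-uniqueOcc132 (sym ∘ ρ≗) outer-occ)

  σ∈D : T (inD σ)
  σ∈D = inD⁺ σ (≗-injectiveOn (sym ∘ σ≗) window-injective) (≗-uniqueOcc132 (sym ∘ σ≗) window-occ)

module Merge {m k : ℕ} (ρ : Vec (Fin m) m) (ρ∈B : T (inB ρ)) (σ : Vec (Fin (k + 3)) (k + 3)) (σ∈D : T (inD σ)) where

  i : ℕ
  i = occStart (occ132 ρ)

  open Backward m k (at ρ) (at σ) i (proj₁ (inB⁻ ρ ρ∈B)) (at-into ρ) (proj₂ (inB⁻ ρ ρ∈B))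
    (proj₁ (inD⁻ σ σ∈D)) (at-into σ) (proj₂ (inD⁻ σ σ∈D)) public

  π′ : Vec (Fin (m + k)) (m + k)
  π′ = wordOf (m + k) π π-into

  π′≗ : ∀ {p} → p < m + k → at π′ p ≡ π p
  π′≗ = at-wordOf π-into

  π′∈A : T (inA k π′) × occStart (occ132 π′) ≡ i
  π′∈A = inA⁺ k π′ (≗-injectiveOn (sym ∘ π′≗) π-injective) (≗-uniqueOcc132 (sym ∘ π′≗) π-occ)

module _ (m k : ℕ) where

  split : SetA (m + k) k → SetB m × SetD (k + 3)
  split (π , π∈A) = (ρ , proj₁ ρ∈B) , (σ , σ∈D)
    where open Split {m} {k} π π∈A

  merge : SetB m × SetD (k + 3) → SetA (m + k) k
  merge ((ρ , ρ∈B) , (σ , σ∈D)) = π′ , proj₁ π′∈A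
    where open Merge {m} {k} ρ ρ∈B σ σ∈D

  merge∘split : ∀ x → merge (split x) ≡ x
  merge∘split (π , π∈A) = ≡-subset (at-injective pointwise)
    where
    open Split {m} {k} π π∈A
    module M = Merge {m} {k} ρ (proj₁ ρ∈B) σ σ∈D
    pointwise : ∀ {p} → p < m + k → at M.π′ p ≡ at π p
    pointwise {p} p<n = begin
      at M.π′ p  ≡⟨ M.π′≗ p<n ⟩
      M.π p      ≡⟨ cong (λ i′ → insertWindow (at ρ) (at σ) i′ k (threshold (at ρ) i′ (suc (suc i′)) m) p) (proj₂ ρ∈B) ⟩
      insertWindow (at ρ) (at σ) i k (threshold (at ρ) i (suc (suc i)) m) p  ≡⟨ insertWindow∘split ρ≗ σ≗ p<n ⟩
      at π p     ∎

  split∘merge : ∀ y → split (merge y) ≡ y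
  split∘merge ((ρ , ρ∈B) , (σ , σ∈D)) =
    cong₂ _,_ (≡-subset (at-injective outer-pointwise)) (≡-subset (at-injective window-pointwise))
    where
    open Merge {m} {k} ρ ρ∈B σ σ∈D
    module S = Split {m} {k} π′ (proj₁ π′∈A)
    outer-pointwise : ∀ {p} → p < m → at S.ρ p ≡ at ρ p
    outer-pointwise {p} p<m = begin
      at S.ρ p  ≡⟨ S.ρ≗ p<m ⟩
      outerPart (at π′) S.i k S.t p
        ≡⟨ cong (λ i′ → outerPart (at π′) i′ k (threshold (at π′) i′ (middle i′ k) (m + k)) p) (proj₂ π′∈A) ⟩
      outerPart (at π′) i k (threshold (at π′) i L n) p  ≡⟨ outerPart∘insertWindow π′≗ p<m ⟩
      at ρ p    ∎
    window-pointwise : ∀ {x} → x < k + 3 → at S.σ x ≡ at σ x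
    window-pointwise {x} x<k+3 = begin
      at S.σ x  ≡⟨ S.σ≗ x<k+3 ⟩
      windowPart (at π′) S.i k S.t x
        ≡⟨ cong (λ i′ → windowPart (at π′) i′ k (threshold (at π′) i′ (middle i′ k) (m + k)) x) (proj₂ π′∈A) ⟩
      windowPart (at π′) i k (threshold (at π′) i L n) x  ≡⟨ windowPart∘insertWindow π′≗ x<k+3 ⟩
      at σ x    ∎

  splitting : SetA (m + k) k ⤖ (SetB m × SetD (k + 3))
  splitting = ↔⇒⤖ (mk↔ₛ′ split merge split∘merge merge∘split)

-- only k ≤ n is used: the bijection exists for every n = (n ∸ k) + k
proposition19 : (n k : ℕ) → 3 ≤ n → k ≤ n ∸ 3 →
    SetA n k ⤖ (SetB (n ∸ k) × SetD (k + 3))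
proposition19 n k _ k≤n∸3 =
  subst (λ N → SetA N k ⤖ (SetB (n ∸ k) × SetD (k + 3))) (m∸n+n≡m (≤-trans k≤n∸3 (m∸n≤m n 3)))
    (splitting (n ∸ k) k)
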